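{- Let $k \ge 1$ and $3 \le m \le n \le k+1$. Then $d_k(P_m \boxtimes P_n) = m+1$.
   Context: $P_n$ is the path on $n$ vertices. $P_m \boxtimes P_n$ is the strong product (strong grid): vertices $(i,j)$, $0\le i\le m-1$, $0\le j\le n-1$, with distinct $(i,j)$, $(i',j')$ adjacent iff $|i-i'|\le 1$ and $|j-j'|\le 1$. The $k$-move deduction game ($k$ a positive integer) on a finite graph $G$: a layout places a finite number of searchers on vertices of $G$ (several searchers may share a vertex). Every searcher is initially mobile. A vertex is protected once it has been occupied by some searcher (so initially occupied vertices are protected); other vertices are unprotected. The game proceeds in stages. At each stage, for every vertex $v$ that has at least one unprotected neighbour: if the number of mobile searchers on $v$ is at least the number of unprotected neighbours of $v$, then the mobile searchers on $v$ move to the unprotected neighbours of $v$ so that each unprotected neighbour receives at least one searcher; excess mobile searchers on $v$ may also move to any of these unprotected neighbours. All moves in a stage happen simultaneously, newly occupied vertices become protected, and a searcher that has moved $k$ times becomes immobile. The process repeats until all vertices are protected or no searcher can move. A layout is successful if all vertices of $G$ end up protected. The $k$-move deduction number $d_k(G)$ is the minimum number of searchers in a successful layout on $G$. -}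

module Defs where

open import Data.Bool using (Bool; true; false; _∧_; _∨_; not; if_then_else_)
open import Data.Nat using (ℕ; zero; suc; _≤ᵇ_; _<ᵇ_; ∣_-_∣)
open import Data.Fin using (Fin; toℕ)
open import Data.Product using (Σ; ∃; ∃-syntax; _×_; _,_; proj₁; proj₂)
open import Data.List using (List; length; filterᵇ; allFin; concatMap; map)
open import Data.Bool.ListAction using (any)
open import Relation.Nullary.Decidable using (⌊_⌋)
open import Relation.Binary.Definitions using (DecidableEquality)
open import Relation.Binary.PropositionalEquality using (_≡_)
open import Relation.Binary.Construct.Closure.ReflexiveTransitive using (Star)

-- A finite (simple) graph: vertex type with decidable equality, a list
-- enumerating all vertices (each exactly once), and Bool-valued adjacency.
record Graph : Set₁ where
  field
    V     : Set
    _≟V_  : DecidableEquality V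
    verts : List V
    adj   : V → V → Bool

strongGrid : ℕ → ℕ → Graph
strongGrid m n = record
  { V     = Fin m × Fin n
  ; _≟V_  = eq
  ; verts = concatMap (λ i → map (λ j → (i , j)) (allFin n)) (allFin m)
  ; adj   = λ p q → not ⌊ eq p q ⌋
                  ∧ (∣ toℕ (proj₁ p) - toℕ (proj₁ q) ∣ ≤ᵇ 1)
                  ∧ (∣ toℕ (proj₂ p) - toℕ (proj₂ q) ∣ ≤ᵇ 1)
  }
  where
  open import Data.Product.Properties using (≡-dec)
  import Data.Fin.Properties as FP
  eq : DecidableEquality (Fin m × Fin n)
  eq = ≡-dec FP._≟_ FP._≟_

module Game (G : Graph) (k : ℕ) where
  open Graph G

  _==_ : V → V → Bool
  u == v = ⌊ u ≟V v ⌋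

  record Config (s : ℕ) : Set where
    constructor config
    field
      pos  : Fin s → V
      used : Fin s → ℕ
      prot : V → Bool
  open Config public

  mobile : ∀ {s} → Config s → Fin s → Bool
  mobile c i = used c i <ᵇ k

  unprotNbrs : ∀ {s} → Config s → V → ℕ
  unprotNbrs c v = length (filterᵇ (λ u → adj v u ∧ not (prot c u)) verts)

  mobileOn : ∀ {s} → Config s → V → ℕ
  mobileOn {s} c v = length (filterᵇ (λ i → (pos c i == v) ∧ mobile c i) (allFin s))

  fires : ∀ {s} → Config s → V → Bool
  fires c v = (1 ≤ᵇ unprotNbrs c v) ∧ (unprotNbrs c v ≤ᵇ mobileOn c v)

  moves : ∀ {s} → Config s → Fin s → Bool
  moves c i = mobile c i ∧ fires c (pos c i)

  Step : ∀ {s} → Config s → Config s → Set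
  Step {s} c c' =
      (∀ i → moves c i ≡ true →
         adj (pos c i) (pos c' i) ≡ true × prot c (pos c' i) ≡ false
         × used c' i ≡ suc (used c i))
    × (∀ i → moves c i ≡ false → pos c' i ≡ pos c i × used c' i ≡ used c i)
    × (∀ v u → fires c v ≡ true → adj v u ≡ true → prot c u ≡ false →
         ∃[ i ] (moves c i ≡ true × pos c i ≡ v × pos c' i ≡ u))
    × (∀ u → prot c' u ≡ (prot c u ∨ any (λ i → pos c' i == u) (allFin s)))

  initial : ∀ {s} → (Fin s → V) → Config s
  initial {s} L = config L (λ _ → 0) (λ u → any (λ i → L i == u) (allFin s))

  Successful : ∀ {s} → (Fin s → V) → Set
  Successful L = ∃[ c ] (Star Step (initial L) c × (∀ v → prot c v ≡ true))

DeductionNumber : Graph → ℕ → ℕ → Set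
DeductionNumber G k d =
    (Σ (Fin d → Graph.V G) (Game.Successful G k))
  × (∀ s (L : Fin s → Graph.V G) → Game.Successful G k L → d Data.Nat.≤ s)

-- Call a set of cells sparse if it has at most m cells or misses a whole row
-- and a whole column. The cells protected by a layout of at most m searchers are sparse,
-- all cells are not. A protected cell with an unprotected neighbour always carries a
-- searcher, since its last searcher can only leave when the cell fires, and firing
-- protects all its neighbours. In the step where sparsity breaks, add the newly protected
-- cells one at a time: some sparse Q grows by one cell into a region T that is not
-- sparse. Counting row by row (or column by column), T meets every row and fills none,
-- which gives a boundary cell in each row, and when T has exactly as many rows as the
-- bound, a row with one cell of T next to a row with two gives one more: T has at least
-- m + 1 cells with a neighbour outside T. Each is watched by its own searcher: one
-- standing on it after the step, or one that left it for a cell outside T.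
--
-- Put two searchers on the first cell of column 0 and one on every other
-- cell of it. The doubled cell has two unprotected neighbours in column 1 and fires;
-- then the searchers of column 0 move diagonally one after the other, each as soon as
-- the cell ahead of it is its only unprotected neighbour, and the last two meet at the
-- far end of column 1. Column 1 now looks like column 0 upside down, so the sweep
-- repeats in the reflected direction, every searcher moving once per column: n - 1 ≤ k
-- moves suffice.

module Submission where

open import Defs
open import Data.Bool using (Bool; true; false; not; _∧_; _∨_; if_then_else_)
open import Data.Bool.Properties using (T-≡; T-∧; ¬-not; ∨-zeroʳ; ∧-zeroʳ; not-involutive)
  renaming (_≟_ to _≟ᵇ_)
open import Data.Bool.ListAction using (any)
open import Data.Empty using (⊥)
open import Data.Fin using (Fin; zero; suc; toℕ; fromℕ<; inject≤; inject₁; combine; opposite)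
import Data.Fin.Properties as Finₚ
open import Data.List using (List; _++_; map; concat; tabulate; allFin; filterᵇ; length)
open import Data.List.Membership.Propositional using (lose)
open import Data.List.Membership.Propositional.Properties using (∈-allFin)
open import Data.List.Properties using (filter-++; length-++; map-tabulate)
open import Data.List.Relation.Unary.Any using (satisfied)
open import Data.List.Relation.Unary.Any.Properties using (any⁺; any⁻)
open import Data.Nat
  using (ℕ; zero; suc; pred; _+_; _*_; _∸_; _≤_; _<_; z≤n; s≤s; _≤?_; _<?_; ∣_-_∣; _≤ᵇ_; _<ᵇ_)
open import Data.Nat.Properties
open import Data.Product using (Σ; ∃; ∃₂; _×_; _,_; proj₁; proj₂; map₂; swap)
open import Data.Product.Properties using (≡-dec)
open import Data.Sum using (_⊎_; inj₁; inj₂; fromInj₁)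
import Data.Sum as Sum
open import Data.Unit using (⊤; tt)
open import Function using (_∘_; id; _⇔_; mk⇔; Equivalence)
open import Function.Definitions using (Injective)
open import Level using (Level)
open import Relation.Binary.Construct.Closure.ReflexiveTransitive using (Star; ε; _◅_; _◅◅_)
open import Relation.Binary.PropositionalEquality
  using (_≡_; _≢_; refl; sym; trans; cong; cong₂; subst; subst₂; module ≡-Reasoning)
open import Relation.Nullary using (¬_; Dec; yes; no; does; contradiction)
open import Relation.Nullary.Decidable
  using (⌊_⌋; T?; toWitness; fromWitness; toWitnessFalse; fromWitnessFalse; _×-dec_; _⊎-dec_)
open import Relation.Unary using (Pred; Decidable)
open import Algebra.Properties.CommutativeMonoid.Sum +-0-commutativeMonoid
  using (sum; ∑-comm; sum-cong-≗)

open Equivalence using (to; from)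

private variable
  ℓ : Level
  A : Set
  a b n x y K : ℕ

-- Booleans, counting and sums over Fin

≤ᵇ-true : x ≤ y → (x ≤ᵇ y) ≡ true
≤ᵇ-true x≤y = to T-≡ (≤⇒≤ᵇ x≤y)

≤ᵇ-true⇒≤ : (x ≤ᵇ y) ≡ true → x ≤ y
≤ᵇ-true⇒≤ e = ≤ᵇ⇒≤ _ _ (from T-≡ e)

≤ᵇ-false : ¬ x ≤ y → (x ≤ᵇ y) ≡ false
≤ᵇ-false x≰y = ¬-not (x≰y ∘ ≤ᵇ-true⇒≤)

<ᵇ-true : x < y → (x <ᵇ y) ≡ true
<ᵇ-true x<y = to T-≡ (<⇒<ᵇ x<y)

<ᵇ-true⇒< : (x <ᵇ y) ≡ true → x < y
<ᵇ-true⇒< e = <ᵇ⇒< _ _ (from T-≡ e)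

⌊⌋-true : (d : Dec A) → A → ⌊ d ⌋ ≡ true
⌊⌋-true d a = to T-≡ (fromWitness {a? = d} a)

⌊⌋-true⇒ : (d : Dec A) → ⌊ d ⌋ ≡ true → A
⌊⌋-true⇒ d e = toWitness {a? = d} (from T-≡ e)

∧-true : ∀ {x y} → x ∧ y ≡ true → x ≡ true × y ≡ true
∧-true {true} y≡true = refl , y≡true

∨-false : ∀ {x y} → x ∨ y ≡ false → x ≡ false × y ≡ false
∨-false {false} y≡false = refl , y≡false

any-allFin : ∀ {s} (p : Fin s → Bool) {i} → p i ≡ true → any p (allFin s) ≡ true
any-allFin p {i} pi = to T-≡ (any⁺ p (lose (∈-allFin i) (from T-≡ pi)))

any-witness : (p : A → Bool) (xs : List A) → any p xs ≡ true → ∃ λ x → p x ≡ true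
any-witness p xs e = map₂ (to T-≡) (satisfied (any⁻ p xs (from T-≡ e)))

infix 4 _⊆ᵇ_ _⊆ᵇ_∪[_]

_⊆ᵇ_ : (A → Bool) → (A → Bool) → Set
p ⊆ᵇ q = ∀ x → p x ≡ true → q x ≡ true

_⊆ᵇ_∪[_] : (A → Bool) → (A → Bool) → A → Set
p ⊆ᵇ q ∪[ y ] = ∀ x → p x ≡ true → q x ≡ true ⊎ x ≡ y

⊆ᵇ-false : {p q : A → Bool} → p ⊆ᵇ q → ∀ v → q v ≡ false → p v ≡ false
⊆ᵇ-false {p = p} p⊆q v qv with p v in pv
... | false = refl
... | true  = contradiction (trans (sym (p⊆q v pv)) qv) λ ()

sum-mono-≤ : {f g : Fin n → ℕ} → (∀ i → f i ≤ g i) → sum f ≤ sum g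
sum-mono-≤ {zero}  f≤g = z≤n
sum-mono-≤ {suc n} f≤g = +-mono-≤ (f≤g zero) (sum-mono-≤ (f≤g ∘ suc))

sum-const : ∀ n c → sum {n} (λ _ → c) ≡ n * c
sum-const zero    c = refl
sum-const (suc n) c = cong (c +_) (sum-const n c)

term≤sum : (f : Fin n → ℕ) (i : Fin n) → f i ≤ sum f
term≤sum f zero    = m≤m+n (f zero) _
term≤sum f (suc i) = ≤-trans (term≤sum (f ∘ suc) i) (m≤n+m _ (f zero))

two-terms≤sum : (f : Fin n → ℕ) {i i′ : Fin n} → i ≢ i′ → f i + f i′ ≤ sum f
two-terms≤sum f {zero}  {zero}   i≢i′ = contradiction refl i≢i′
two-terms≤sum f {zero}  {suc i′} _    = +-monoʳ-≤ (f zero) (term≤sum (f ∘ suc) i′)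
two-terms≤sum f {suc i} {zero}   _    =
  subst (_≤ sum f) (+-comm (f zero) _) (+-monoʳ-≤ (f zero) (term≤sum (f ∘ suc) i))
two-terms≤sum f {suc i} {suc i′} i≢i′ =
  ≤-trans (two-terms≤sum (f ∘ suc) (i≢i′ ∘ cong suc)) (m≤n+m _ (f zero))

-- f i + (n ∸ 1) ≤ sum f, stated without truncated subtraction.
term+n≤1+sum : (f : Fin n → ℕ) → (∀ i → 1 ≤ f i) → (i : Fin n) → f i + n ≤ suc (sum f)
term+n≤1+sum {suc n} f pos zero = begin
  f zero + suc n          ≡⟨ +-suc (f zero) n ⟩
  suc (f zero + n)        ≡⟨ cong (λ x → suc (f zero + x)) (sym (*-identityʳ n)) ⟩
  suc (f zero + n * 1)    ≡⟨ cong (λ x → suc (f zero + x)) (sym (sum-const n 1)) ⟩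
  suc (f zero + sum {n} (λ _ → 1)) ≤⟨ s≤s (+-monoʳ-≤ (f zero) (sum-mono-≤ (pos ∘ suc))) ⟩
  suc (sum f)             ∎
  where open ≤-Reasoning
term+n≤1+sum {suc n} f pos (suc i) = begin
  f (suc i) + suc n       ≡⟨ +-suc (f (suc i)) n ⟩
  suc (f (suc i) + n)     ≤⟨ s≤s (term+n≤1+sum (f ∘ suc) (pos ∘ suc) i) ⟩
  suc (suc (sum (f ∘ suc))) ≤⟨ s≤s (+-monoˡ-≤ _ (pos zero)) ⟩
  suc (sum f)             ∎
  where open ≤-Reasoning

sum-mono-≤-except : (f g : Fin n → ℕ) (i₀ : Fin n) → (∀ i → i ≢ i₀ → f i ≤ g i) →
                    f i₀ ≤ suc (g i₀) → sum f ≤ suc (sum g)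
sum-mono-≤-except f g zero     f≤g f₀≤ =
  +-mono-≤ f₀≤ (sum-mono-≤ (λ i → f≤g (suc i) λ ()))
sum-mono-≤-except f g (suc i₀) f≤g f₀≤ = begin
  f zero + sum (f ∘ suc)          ≤⟨ +-mono-≤ (f≤g zero λ ())
                                       (sum-mono-≤-except (f ∘ suc) (g ∘ suc) i₀
                                         (λ i i≢i₀ → f≤g (suc i) (i≢i₀ ∘ Finₚ.suc-injective)) f₀≤) ⟩
  g zero + suc (sum (g ∘ suc))    ≡⟨ +-suc (g zero) _ ⟩
  suc (sum g)                     ∎
  where open ≤-Reasoning

positive-term : (f : Fin n → ℕ) → 1 ≤ sum f → ∃ λ i → 1 ≤ f i
positive-term {suc n} f 1≤sum with f zero in eq
... | suc _ = zero , ≤-trans (s≤s z≤n) (≤-reflexive (sym eq))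
... | zero  = let i , 1≤fi = positive-term (f ∘ suc) 1≤sum in suc i , 1≤fi

bit : Bool → ℕ
bit b = if b then 1 else 0

count : (Fin n → Bool) → ℕ
count p = sum (bit ∘ p)

bit≤1 : ∀ b → bit b ≤ 1
bit≤1 true  = ≤-refl
bit≤1 false = z≤n

bit-mono : ∀ {a b} → (a ≡ true → b ≡ true) → bit a ≤ bit b
bit-mono {true}  a⇒b rewrite a⇒b refl = ≤-refl
bit-mono {false} _   = z≤n

count-mono : {p q : Fin n → Bool} → p ⊆ᵇ q → count p ≤ count q
count-mono p⊆q = sum-mono-≤ (λ i → bit-mono (p⊆q i))

count-all : (p : Fin n → Bool) → (∀ i → p i ≡ true) → count p ≡ n
count-all {n} p all = begin
  count p             ≡⟨ sum-cong-≗ (cong bit ∘ all) ⟩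
  sum {n} (λ _ → 1)   ≡⟨ sum-const n 1 ⟩
  n * 1               ≡⟨ *-identityʳ n ⟩
  n                   ∎
  where open ≡-Reasoning

count-none : (p : Fin n → Bool) → (∀ i → p i ≡ false) → count p ≡ 0
count-none {n} p none = trans (sum-cong-≗ (cong bit ∘ none)) (trans (sum-const n 0) (*-zeroʳ n))

witness⇒1≤count : (p : Fin n → Bool) {i : Fin n} → p i ≡ true → 1 ≤ count p
witness⇒1≤count p {i} pi = ≤-trans (≤-reflexive (cong bit (sym pi))) (term≤sum (bit ∘ p) i)

1≤count⇒witness : (p : Fin n → Bool) → 1 ≤ count p → ∃ λ i → p i ≡ true
1≤count⇒witness p 1≤count with positive-term (bit ∘ p) 1≤count
... | i , 1≤bit with p i in eq
...   | true  = i , eq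
...   | false = contradiction 1≤bit λ ()

witnesses⇒2≤count : (p : Fin n → Bool) {i i′ : Fin n} → i ≢ i′ →
                    p i ≡ true → p i′ ≡ true → 2 ≤ count p
witnesses⇒2≤count p i≢i′ pi pi′ = ≤-trans
  (≤-reflexive (cong₂ (λ a b → bit a + bit b) (sym pi) (sym pi′)))
  (two-terms≤sum (bit ∘ p) i≢i′)

2≤count⇒witnesses : (p : Fin n → Bool) → 2 ≤ count p →
                    ∃₂ λ i i′ → i ≢ i′ × p i ≡ true × p i′ ≡ true
2≤count⇒witnesses {suc n} p 2≤count with p zero in eq
... | true  = let i , pi = 1≤count⇒witness (p ∘ suc) (≤-pred 2≤count) in
              zero , suc i , (λ ()) , eq , pi
... | false = let i , i′ , i≢i′ , pi , pi′ = 2≤count⇒witnesses (p ∘ suc) 2≤count in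
              suc i , suc i′ , i≢i′ ∘ Finₚ.suc-injective , pi , pi′

unique⇒count≤1 : (p : Fin n → Bool) (i₀ : Fin n) → (∀ i → p i ≡ true → i ≡ i₀) → count p ≤ 1
unique⇒count≤1 p i₀ unique with 2 ≤? count p
... | no  2≰count = ≤-pred (≰⇒> 2≰count)
... | yes 2≤count = let i , i′ , i≢i′ , pi , pi′ = 2≤count⇒witnesses p 2≤count in
                    contradiction (trans (unique i pi) (sym (unique i′ pi′))) i≢i′

count<n⇒counterexample : (p : Fin n → Bool) → count p < n → ∃ λ i → p i ≡ false
count<n⇒counterexample {suc n} p count<n with p zero in eq
... | false = zero , eq
... | true  = let i , pi = count<n⇒counterexample (p ∘ suc) (≤-pred count<n) in suc i , pi

count-insert : (p q : Fin n → Bool) (i₀ : Fin n) → p ⊆ᵇ q ∪[ i₀ ] →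
               count p ≤ suc (count q)
count-insert p q i₀ p⊆q+i₀ = sum-mono-≤-except (bit ∘ p) (bit ∘ q) i₀
  (λ i i≢i₀ → bit-mono λ pi → fromInj₁ (λ i≡i₀ → contradiction i≡i₀ i≢i₀) (p⊆q+i₀ i pi))
  (≤-trans (bit≤1 (p i₀)) (s≤s z≤n))

length-filterᵇ-++ : (p : A → Bool) (xs ys : List A) →
                    length (filterᵇ p (xs ++ ys)) ≡ length (filterᵇ p xs) + length (filterᵇ p ys)
length-filterᵇ-++ p xs ys = trans (cong length (filter-++ (T? ∘ p) xs ys)) (length-++ (filterᵇ p xs))

length-filterᵇ-tabulate : (p : A → Bool) (g : Fin n → A) → length (filterᵇ p (tabulate g)) ≡ count (p ∘ g)
length-filterᵇ-tabulate {n = zero}  p g = refl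
length-filterᵇ-tabulate {n = suc n} p g with p (g zero)
... | true  = cong suc (length-filterᵇ-tabulate p (g ∘ suc))
... | false = length-filterᵇ-tabulate p (g ∘ suc)

length-filterᵇ-concat : (p : A → Bool) (h : Fin n → List A) →
                        length (filterᵇ p (concat (tabulate h))) ≡ sum (λ i → length (filterᵇ p (h i)))
length-filterᵇ-concat {n = zero}  p h = refl
length-filterᵇ-concat {n = suc n} p h =
  trans (length-filterᵇ-++ p (h zero) _) (cong (length (filterᵇ p (h zero)) +_) (length-filterᵇ-concat p (h ∘ suc)))

first-failure : {P : ℕ → Set ℓ} → (∀ r → Dec (P r)) → P 0 → ∀ N → ¬ P N →
                ∃ λ r → P r × ¬ P (suc r)
first-failure P? p₀ zero    ¬pN = contradiction p₀ ¬pN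
first-failure P? p₀ (suc N) ¬pN with P? N
... | yes pN  = N , pN , ¬pN
... | no  ¬pN′ = first-failure P? p₀ N ¬pN′

-- Regions of a grid and their boundaries

Near : ℕ → ℕ → Set
Near x y = x ≤ suc y × y ≤ suc x

Near-refl : ∀ x → Near x x
Near-refl x = n≤1+n x , n≤1+n x

Near-sym : Near x y → Near y x
Near-sym (x≤1+y , y≤1+x) = y≤1+x , x≤1+y

Near-suc : ∀ x → Near x (suc x)
Near-suc x = m≤n⇒m≤1+n (n≤1+n x) , ≤-refl

∣-∣≤1⇒Near : ∀ x y → ∣ x - y ∣ ≤ 1 → Near x y
∣-∣≤1⇒Near zero          zero          _          = z≤n , z≤n
∣-∣≤1⇒Near zero          (suc zero)    _          = z≤n , ≤-refl
∣-∣≤1⇒Near (suc zero)    zero          _          = ≤-refl , z≤n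
∣-∣≤1⇒Near (suc x)       (suc y)       ∣x-y∣≤1    =
  let x≤1+y , y≤1+x = ∣-∣≤1⇒Near x y ∣x-y∣≤1 in s≤s x≤1+y , s≤s y≤1+x
∣-∣≤1⇒Near zero          (suc (suc y)) (s≤s ())
∣-∣≤1⇒Near (suc (suc x)) zero          (s≤s ())

Near⇒∣-∣≤1 : ∀ x y → Near x y → ∣ x - y ∣ ≤ 1
Near⇒∣-∣≤1 zero          zero          _                    = z≤n
Near⇒∣-∣≤1 zero          (suc zero)    _                    = ≤-refl
Near⇒∣-∣≤1 (suc zero)    zero          _                    = ≤-refl
Near⇒∣-∣≤1 (suc x)       (suc y)       (s≤s x≤1+y , s≤s y≤1+x) = Near⇒∣-∣≤1 x y (x≤1+y , y≤1+x)
Near⇒∣-∣≤1 zero          (suc (suc y)) (_ , s≤s ())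
Near⇒∣-∣≤1 (suc (suc x)) zero          (s≤s () , _)

Near-∸ : ∀ N {x y} → x ≤ N → y ≤ N → Near x y → Near (N ∸ x) (N ∸ y)
Near-∸ N       {zero}  {zero}  _         _         _                 = Near-refl N
Near-∸ N       {zero}  {suc zero} _      _         _                 = m≤n+m∸n N 1 , m≤n⇒m≤1+n (m∸n≤m N 1)
Near-∸ N       {suc zero} {zero} _       _         _                 = m≤n⇒m≤1+n (m∸n≤m N 1) , m≤n+m∸n N 1
Near-∸ (suc N) {suc x} {suc y} (s≤s x≤N) (s≤s y≤N) (s≤s x≤1+y , s≤s y≤1+x) =
  Near-∸ N x≤N y≤N (x≤1+y , y≤1+x)
Near-∸ N       {zero}  {suc (suc y)} _   _         (_ , s≤s ())
Near-∸ N       {suc (suc x)} {zero} _    _         (s≤s () , _)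

Consecutive : Fin n → Fin n → Set
Consecutive i i′ = i ≢ i′ × Near (toℕ i) (toℕ i′)

Consecutive-sym : {i i′ : Fin n} → Consecutive i i′ → Consecutive i′ i
Consecutive-sym (i≢i′ , near) = i≢i′ ∘ sym , Near-sym near

Consecutive-suc : {i i′ : Fin n} → Consecutive i i′ → Consecutive (suc i) (suc i′)
Consecutive-suc (i≢i′ , x≤1+y , y≤1+x) = i≢i′ ∘ Finₚ.suc-injective , s≤s x≤1+y , s≤s y≤1+x

consecutive-0-1 : Consecutive {suc (suc n)} zero (suc zero)
consecutive-0-1 = (λ ()) , Near-suc 0

consecutive-exists : 2 ≤ n → (i : Fin n) → ∃ (Consecutive i)
consecutive-exists {suc zero}    (s≤s ()) zero
consecutive-exists {suc (suc n)} _ zero    = suc zero , consecutive-0-1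
consecutive-exists {suc (suc n)} _ (suc i) = inject₁ i , i≢ , near
  where
  i≢ : suc i ≢ inject₁ i
  i≢ eq = 1+n≢n (trans (cong toℕ eq) (Finₚ.toℕ-inject₁ i))
  near : Near (suc (toℕ i)) (toℕ (inject₁ i))
  near rewrite Finₚ.toℕ-inject₁ i = Near-sym (Near-suc (toℕ i))

discrete-ivt : {P : Pred (Fin n) ℓ} → Decidable P → ∀ {i i′} → P i → ¬ P i′ →
         ∃₂ λ j j′ → Consecutive j j′ × P j × ¬ P j′
discrete-ivt {suc zero} P? {zero} {zero} pi ¬pi′ = contradiction pi ¬pi′
discrete-ivt {suc (suc n)} {P = P} P? {i} {i′} pi ¬pi′ = go i i′ pi ¬pi′ (P? zero) (P? (suc zero))
  where
  lift : (∃₂ λ j j′ → Consecutive j j′ × P (suc j) × ¬ P (suc j′)) →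
         ∃₂ λ j j′ → Consecutive j j′ × P j × ¬ P j′
  lift (j , j′ , cons , pj , ¬pj′) = suc j , suc j′ , Consecutive-suc cons , pj , ¬pj′
  go : ∀ i i′ → P i → ¬ P i′ → Dec (P zero) → Dec (P (suc zero)) →
       ∃₂ λ j j′ → Consecutive j j′ × P j × ¬ P j′
  go _ _        _  _    (yes p₀)  (no ¬p₁) = zero , suc zero , consecutive-0-1 , p₀ , ¬p₁
  go _ _        _  _    (no ¬p₀)  (yes p₁) = suc zero , zero , Consecutive-sym consecutive-0-1 , p₁ , ¬p₀
  go _ zero     _  ¬pi′ (yes p₀)  (yes _)  = contradiction p₀ ¬pi′
  go _ (suc i′) _  ¬pi′ (yes _)   (yes p₁) = lift (discrete-ivt (P? ∘ suc) {zero} {i′} p₁ ¬pi′)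
  go zero _     pi _    (no ¬p₀)  (no _)   = contradiction pi ¬p₀
  go (suc i) _  pi _    (no _)    (no ¬p₁) = lift (discrete-ivt (P? ∘ suc) {i} {zero} pi ¬p₁)

Cell : ℕ → ℕ → Set
Cell a b = Fin a × Fin b

Region : ℕ → ℕ → Set
Region a b = Cell a b → Bool

Adjacent : Cell a b → Cell a b → Set
Adjacent p q = p ≢ q × Near (toℕ (proj₁ p)) (toℕ (proj₁ q)) × Near (toℕ (proj₂ p)) (toℕ (proj₂ q))

Adjacent-transpose : {p q : Cell a b} → Adjacent p q → Adjacent (swap p) (swap q)
Adjacent-transpose (p≢q , near₁ , near₂) = p≢q ∘ cong swap , near₂ , near₁

rowCount : Region a b → Fin a → ℕ
rowCount T i = count (λ j → T (i , j))

size : Region a b → ℕ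
size T = sum (rowCount T)

size-transpose : (T : Region a b) → size (T ∘ swap) ≡ size T
size-transpose T = sym (∑-comm (λ i j → bit (T (i , j))))

size-mono : {T Q : Region a b} → T ⊆ᵇ Q → size T ≤ size Q
size-mono T⊆Q = sum-mono-≤ (λ i → count-mono (λ j → T⊆Q (i , j)))

size-insert : (T Q : Region a b) (x : Cell a b) → T ⊆ᵇ Q ∪[ x ] → size T ≤ suc (size Q)
size-insert T Q (i₀ , j₀) T⊆Q+x = sum-mono-≤-except (rowCount T) (rowCount Q) i₀ other-row x-row
  where
  other-row : ∀ i → i ≢ i₀ → rowCount T i ≤ rowCount Q i
  other-row i i≢i₀ = count-mono λ j Tij →
    fromInj₁ (λ eq → contradiction (cong proj₁ eq) i≢i₀) (T⊆Q+x (i , j) Tij)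
  x-row : rowCount T i₀ ≤ suc (rowCount Q i₀)
  x-row = count-insert _ _ j₀ λ j Ti₀j → Sum.map₂ (cong proj₂) (T⊆Q+x (i₀ , j) Ti₀j)

size-empty : (T : Region a b) → (∀ v → T v ≡ false) → size T ≡ 0
size-empty {a} T empty = begin
  size T                 ≡⟨ sum-cong-≗ (λ i → count-none _ (λ j → empty (i , j))) ⟩
  sum {a} (λ _ → 0)      ≡⟨ sum-const a 0 ⟩
  a * 0                  ≡⟨ *-zeroʳ a ⟩
  0                      ∎
  where open ≡-Reasoning

witness⇒1≤size : (T : Region a b) {v : Cell a b} → T v ≡ true → 1 ≤ size T
witness⇒1≤size T {i , j} Tv = ≤-trans (witness⇒1≤count (λ j → T (i , j)) Tv) (term≤sum (rowCount T) i)

witnesses⇒2≤size : (T : Region a b) {u v : Cell a b} → u ≢ v → T u ≡ true → T v ≡ true → 2 ≤ size T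
witnesses⇒2≤size T {i , j} {i′ , j′} u≢v Tu Tv with i Finₚ.≟ i′
... | yes refl = ≤-trans (witnesses⇒2≤count (λ j → T (i , j)) (u≢v ∘ cong (i ,_)) Tu Tv)
                         (term≤sum (rowCount T) i)
... | no  i≢i′ = ≤-trans (+-mono-≤ (witness⇒1≤count (λ j → T (i , j)) Tu)
                                    (witness⇒1≤count (λ j → T (i′ , j)) Tv))
                         (two-terms≤sum (rowCount T) i≢i′)

_≟ᶜ_ : (u v : Cell a b) → Dec (u ≡ v)
_≟ᶜ_ = ≡-dec Finₚ._≟_ Finₚ._≟_

⊆ᵇ-or-extra : (T Q : Region a b) → T ⊆ᵇ Q ⊎ ∃ λ x → T x ≡ true × Q x ≡ false
⊆ᵇ-or-extra T Q with Finₚ.any? (λ i → Finₚ.any? (λ j → (T (i , j) ≟ᵇ true) ×-dec (Q (i , j) ≟ᵇ false)))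
... | yes (i , j , extra) = inj₂ ((i , j) , extra)
... | no  none = inj₁ λ v Tv → ¬-not (λ Qv → none (proj₁ v , proj₂ v , Tv , Qv))

size≤image : ∀ {k} (h : Fin k → Cell a b) (T : Region a b) → (∀ u → T u ≡ true → ∃ λ i → h i ≡ u) →
             size T ≤ k
size≤image {k = zero}  h T onto =
  ≤-reflexive (size-empty T λ v → ¬-not (λ Tv → Finₚ.¬Fin0 (proj₁ (onto v Tv))))
size≤image {k = suc k} h T onto =
  ≤-trans (size-insert T T′ (h zero) T⊆T′+h₀) (s≤s (size≤image (h ∘ suc) T′ onto′))
  where
  T′ : Region _ _
  T′ u = T u ∧ not (does (u ≟ᶜ h zero))
  T⊆T′+h₀ : T ⊆ᵇ T′ ∪[ h zero ]
  T⊆T′+h₀ u Tu with u ≟ᶜ h zero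
  ... | yes u≡h₀ = inj₂ u≡h₀
  ... | no  _    rewrite Tu = inj₁ refl
  onto′ : ∀ u → T′ u ≡ true → ∃ λ i → h (suc i) ≡ u
  onto′ u T′u with T u in Tu | u ≟ᶜ h zero
  ... | true | no u≢h₀ with onto u Tu
  ...   | zero  , h₀≡u = contradiction (sym h₀≡u) u≢h₀
  ...   | suc i , hi≡u = i , hi≡u

OnBoundary : Region a b → Cell a b → Set
OnBoundary T v = T v ≡ true × ∃ λ u → Adjacent v u × T u ≡ false

BoundaryAtLeast : ℕ → Region a b → Set
BoundaryAtLeast {a} {b} k T =
  ∃ λ (f : Fin k → Cell a b) → Injective _≡_ _≡_ f × (∀ i → OnBoundary T (f i))

BoundaryAtLeast-≤ : ∀ {k k′} {T : Region a b} → k′ ≤ k → BoundaryAtLeast k T → BoundaryAtLeast k′ T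
BoundaryAtLeast-≤ k′≤k (f , f-inj , bd) =
  (λ i → f (inject≤ i k′≤k)) ,
  (λ eq → Finₚ.inject≤-injective k′≤k k′≤k _ _ (f-inj eq)) ,
  (λ i → bd _)

BoundaryAtLeast-transpose : ∀ {k} {T : Region a b} → BoundaryAtLeast k (T ∘ swap) → BoundaryAtLeast k T
BoundaryAtLeast-transpose (f , f-inj , bd) =
  swap ∘ f , (λ eq → f-inj (cong swap eq)) ,
  (λ i → let Tv , u , adj , Tu = bd i in Tv , swap u , Adjacent-transpose adj , Tu)

row-boundary : (T : Region a b) (i : Fin a) → (∃ λ j → T (i , j) ≡ true) → (∃ λ j → T (i , j) ≡ false) →
               ∃ λ j → OnBoundary T (i , j)
row-boundary T i (j₁ , Tij₁) (j₂ , Tij₂)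
  with discrete-ivt (λ j → T (i , j) ≟ᵇ true) Tij₁ (λ eq → contradiction (trans (sym Tij₂) eq) λ ())
... | j , j′ , (j≢j′ , near) , Tij , ¬Tij′ =
  j , Tij , (i , j′) , (j≢j′ ∘ cong proj₂ , Near-refl (toℕ i) , near) , ¬-not ¬Tij′

module RowBoundaries (T : Region a b)
                     (meets  : ∀ i → ∃ λ j → T (i , j) ≡ true)
                     (misses : ∀ i → ∃ λ j → T (i , j) ≡ false) where

  boundaryColumn : Fin a → Fin b
  boundaryColumn i = proj₁ (row-boundary T i (meets i) (misses i))

  one-per-row : BoundaryAtLeast a T
  one-per-row = (λ i → i , boundaryColumn i) , cong proj₁ ,
                (λ i → proj₂ (row-boundary T i (meets i) (misses i)))

  -- Of two cells of row rs next to (rd , j), at most one belongs to T.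
  next-to-sparse-row : 2 ≤ b → ∀ {rs rd} → Consecutive rs rd → rowCount T rs ≤ 1 →
                       ∀ j → T (rd , j) ≡ true → OnBoundary T (rd , j)
  next-to-sparse-row b≥2 {rs} {rd} (rs≢rd , near) rs≤1 j Trdj with T (rs , j) in Trsj
  ... | false = Trdj , (rs , j) , ((rs≢rd ∘ sym) ∘ cong proj₁ , Near-sym near , Near-refl (toℕ j)) , Trsj
  ... | true with consecutive-exists b≥2 j
  ...   | j′ , j≢j′ , near′ with T (rs , j′) in Trsj′
  ...     | false = Trdj , (rs , j′) , ((rs≢rd ∘ sym) ∘ cong proj₁ , Near-sym near , near′) , Trsj′
  ...     | true  = contradiction
                      (≤-trans (witnesses⇒2≤count (λ j → T (rs , j)) j≢j′ Trsj Trsj′) rs≤1) 1+n≰n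

  one-per-row+1 : 2 ≤ b → ∀ {rs rd} → Consecutive rs rd → rowCount T rs ≤ 1 → 2 ≤ rowCount T rd →
                  BoundaryAtLeast (suc a) T
  one-per-row+1 b≥2 {rs} {rd} cons rs≤1 rd≥2 = g , g-inj , g-boundary
    where
    extra : ∃ λ je → je ≢ boundaryColumn rd × T (rd , je) ≡ true
    extra with 2≤count⇒witnesses (λ j → T (rd , j)) rd≥2
    ... | j₁ , j₂ , j₁≢j₂ , Tj₁ , Tj₂ with j₁ Finₚ.≟ boundaryColumn rd
    ...   | no  j₁≢ = j₁ , j₁≢ , Tj₁
    ...   | yes j₁≡ = j₂ , (λ j₂≡ → j₁≢j₂ (trans j₁≡ (sym j₂≡))) , Tj₂
    je = proj₁ extra
    g : Fin (suc a) → Cell a b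
    g zero    = rd , je
    g (suc i) = i , boundaryColumn i
    g-inj : Injective _≡_ _≡_ g
    g-inj {zero}  {zero}  _  = refl
    g-inj {suc i} {suc _} eq = cong suc (cong proj₁ eq)
    g-inj {zero}  {suc i} eq with cong proj₁ eq
    ... | refl = contradiction (cong proj₂ eq) (proj₁ (proj₂ extra))
    g-inj {suc i} {zero}  eq with cong proj₁ eq
    ... | refl = contradiction (sym (cong proj₂ eq)) (proj₁ (proj₂ extra))
    g-boundary : ∀ i → OnBoundary T (g i)
    g-boundary zero    = next-to-sparse-row b≥2 cons rs≤1 je (proj₂ (proj₂ extra))
    g-boundary (suc i) = proj₂ (row-boundary T i (meets i) (misses i))

MissesRow : Region a b → Set
MissesRow {a} {b} T = ∃ λ (i : Fin a) → ∀ (j : Fin b) → T (i , j) ≡ false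

MissesColumn : Region a b → Set
MissesColumn {a} {b} T = ∃ λ (j : Fin b) → ∀ (i : Fin a) → T (i , j) ≡ false

-- The protected cells are sparse for any layout of at most m searchers, and not sparse
-- once every cell is protected.
Sparse : ℕ → Region a b → Set
Sparse K T = size T ≤ K ⊎ (MissesRow T × MissesColumn T)

missesRow? : (T : Region a b) → Dec (MissesRow T)
missesRow? T = Finₚ.any? (λ i → Finₚ.all? (λ j → T (i , j) ≟ᵇ false))

missesColumn? : (T : Region a b) → Dec (MissesColumn T)
missesColumn? T = Finₚ.any? (λ j → Finₚ.all? (λ i → T (i , j) ≟ᵇ false))

sparse? : ∀ K (T : Region a b) → Dec (Sparse K T)
sparse? K T = (size T ≤? K) ⊎-dec (missesRow? T ×-dec missesColumn? T)

Sparse-mono : {T Q : Region a b} → T ⊆ᵇ Q → Sparse K Q → Sparse K T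
Sparse-mono T⊆Q (inj₁ size≤K) = inj₁ (≤-trans (size-mono T⊆Q) size≤K)
Sparse-mono T⊆Q (inj₂ ((i , row-i) , (j , col-j))) =
  inj₂ ((i , λ j′ → ⊆ᵇ-false T⊆Q _ (row-i j′)) , (j , λ i′ → ⊆ᵇ-false T⊆Q _ (col-j i′)))

Sparse-transpose : {T : Region a b} → Sparse K T → Sparse K (T ∘ swap)
Sparse-transpose {T = T} (inj₁ size≤K) = inj₁ (subst (_≤ _) (sym (size-transpose T)) size≤K)
Sparse-transpose (inj₂ (row , column))  = inj₂ (column , row)

meets-every-row : (T : Region a b) → ¬ MissesRow T → ∀ i → ∃ λ j → T (i , j) ≡ true
meets-every-row T ¬miss i with Finₚ.any? (λ j → T (i , j) ≟ᵇ true)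
... | yes found = found
... | no  none  = contradiction (i , λ j → ¬-not (λ Tij → none (j , Tij))) ¬miss

crowded-row : (T : Region a b) → a < size T → ∃ λ i → 2 ≤ rowCount T i
crowded-row {a} T a<size with Finₚ.any? (λ i → 2 ≤? rowCount T i)
... | yes found = found
... | no  none  = contradiction a<size (≤⇒≯ (begin
  size T               ≤⟨ sum-mono-≤ (λ i → ≤-pred (≰⇒> (λ ≥2 → none (i , ≥2)))) ⟩
  sum {a} (λ _ → 1)    ≡⟨ sum-const a 1 ⟩
  a * 1                ≡⟨ *-identityʳ a ⟩
  a                    ∎))
  where open ≤-Reasoning

module AddOneCell {T Q : Region a b} {x : Cell a b} (T⊆Q+x : T ⊆ᵇ Q ∪[ x ]) where

  outside : ∀ v → Q v ≡ false → v ≢ x → T v ≡ false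
  outside v Qv v≢x with T v in Tv
  ... | false = refl
  ... | true with T⊆Q+x v Tv
  ...   | inj₁ Qv′ = contradiction (trans (sym Qv′) Qv) λ ()
  ...   | inj₂ v≡x = contradiction v≡x v≢x

  size-T≤1+size-Q : size T ≤ suc (size Q)
  size-T≤1+size-Q = size-insert T Q x T⊆Q+x

  -- If Q is small, a full row of T together with one cell in every other row would already
  -- exceed size Q + 1; if Q misses a row and a column, in that row and column only x can
  -- belong to T.
  rows-not-full : 3 ≤ b → K ≤ a → Sparse K Q → (∀ i → ∃ λ j → T (i , j) ≡ true) →
                  ∀ i → ∃ λ j → T (i , j) ≡ false
  rows-not-full {K = K} b≥3 K≤a (inj₁ sizeQ≤K) meets i with rowCount T i <? b
  ... | yes not-full = count<n⇒counterexample _ not-full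
  ... | no  full     = contradiction (+-cancelʳ-≤ a b 2 b+a≤2+a) (<⇒≱ b≥3)
    where
    b+a≤2+a : b + a ≤ 2 + a
    b+a≤2+a = begin
      b + a               ≤⟨ +-monoˡ-≤ a (≮⇒≥ full) ⟩
      rowCount T i + a    ≤⟨ term+n≤1+sum (rowCount T)
                               (λ i → witness⇒1≤count (λ j → T (i , j)) (proj₂ (meets i))) i ⟩
      suc (size T)        ≤⟨ s≤s size-T≤1+size-Q ⟩
      2 + size Q          ≤⟨ +-monoʳ-≤ 2 (≤-trans sizeQ≤K K≤a) ⟩
      2 + a               ∎
      where open ≤-Reasoning
  rows-not-full b≥3 _ (inj₂ ((r₀ , Q-r₀) , (c₀ , Q-c₀))) meets i with i Finₚ.≟ r₀
  ... | yes refl = let j′ , j≢j′ , _ = consecutive-exists (≤-trans (n≤1+n 2) b≥3) (proj₂ x) in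
                   j′ , outside (r₀ , j′) (Q-r₀ j′) (j≢j′ ∘ sym ∘ cong proj₂)
  ... | no  i≢r₀ = c₀ , outside (i , c₀) (Q-c₀ i) (λ eq → i≢r₀ (trans (cong proj₁ eq) x-in-r₀))
    where
    x-in-r₀ : proj₁ x ≡ r₀
    x-in-r₀ with T⊆Q+x _ (proj₂ (meets r₀))
    ... | inj₁ Qv  = contradiction (trans (sym Qv) (Q-r₀ _)) λ ()
    ... | inj₂ v≡x = sym (cong proj₁ v≡x)

  sparse-row : 2 ≤ a → Sparse a Q → ∃ λ i → rowCount T i ≤ 1
  sparse-row _ (inj₂ ((r₀ , Q-r₀) , _)) = r₀ , unique⇒count≤1 _ (proj₂ x) only-x
    where
    only-x : ∀ j → T (r₀ , j) ≡ true → j ≡ proj₂ x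
    only-x j Tr₀j with T⊆Q+x _ Tr₀j
    ... | inj₁ Qv  = contradiction (trans (sym Qv) (Q-r₀ j)) λ ()
    ... | inj₂ v≡x = cong proj₂ v≡x
  sparse-row a≥2 (inj₁ sizeQ≤a) with Finₚ.any? (λ i → rowCount T i ≤? 1)
  ... | yes found = found
  ... | no  none  = contradiction (+-cancelʳ-≤ a a 1 (+-cancelʳ-≤ a (a + a) (1 + a) 3a≤1+2a)) (<⇒≱ a≥2)
    where
    3a≤1+2a : a + a + a ≤ 1 + a + a
    3a≤1+2a = begin
      a + a + a           ≡⟨ cong (λ z → a + z + a) (sym (+-identityʳ a)) ⟩
      2 * a + a           ≡⟨ cong (_+ a) (*-comm 2 a) ⟩
      a * 2 + a           ≡⟨ cong (_+ a) (sym (sum-const a 2)) ⟩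
      sum {a} (λ _ → 2) + a ≤⟨ +-monoˡ-≤ a (sum-mono-≤ (λ i → ≰⇒> (λ ≤1 → none (i , ≤1)))) ⟩
      size T + a          ≤⟨ +-monoˡ-≤ a size-T≤1+size-Q ⟩
      suc (size Q) + a    ≤⟨ +-monoˡ-≤ a (s≤s sizeQ≤a) ⟩
      1 + a + a           ∎
      where open ≤-Reasoning

  boundary-growth : 3 ≤ b → 2 ≤ a → K ≤ a → Sparse K Q → K < size T →
                    (∀ i → ∃ λ j → T (i , j) ≡ true) → BoundaryAtLeast (suc K) T
  boundary-growth {K = K} b≥3 a≥2 K≤a sparse K<size meets with K <? a
  ... | yes K<a = BoundaryAtLeast-≤ K<a one-per-row
    where open RowBoundaries T meets (rows-not-full b≥3 K≤a sparse meets)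
  ... | no  K≮a with ≤-antisym K≤a (≮⇒≥ K≮a)
  ...   | refl with sparse-row a≥2 sparse | crowded-row T K<size
  ...     | rs , rs≤1 | rd , rd≥2 with discrete-ivt (λ i → rowCount T i ≤? 1) rs≤1 (<⇒≱ rd≥2)
  ...       | r , r′ , cons , r≤1 , r′≰1 =
    one-per-row+1 (≤-trans (n≤1+n 2) b≥3) cons r≤1 (≰⇒> r′≰1)
    where open RowBoundaries T meets (rows-not-full b≥3 K≤a sparse meets)

-- Transposing if necessary, T meets every row; either way there are at least m rows of at
-- least 3 cells, so that AddOneCell.boundary-growth applies with K = m.
boundary-when-sparsity-breaks : ∀ {m n} → 3 ≤ m → m ≤ n → {T Q : Region m n} {x : Cell m n} →
                                T ⊆ᵇ Q ∪[ x ] → Sparse m Q → ¬ Sparse m T → BoundaryAtLeast (suc m) T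
boundary-when-sparsity-breaks {m} {n} m≥3 m≤n {T} {Q} {x} T⊆Q+x sparseQ ¬sparseT with missesRow? T
... | no ¬missR =
  AddOneCell.boundary-growth T⊆Q+x (≤-trans m≥3 m≤n) m≥2 ≤-refl sparseQ m<size (meets-every-row T ¬missR)
  where
  m≥2 = ≤-trans (n≤1+n 2) m≥3
  m<size = ≰⇒> (¬sparseT ∘ inj₁)
... | yes missR = BoundaryAtLeast-transpose
  (AddOneCell.boundary-growth T⊆Q+x′ m≥3 (≤-trans m≥2 m≤n) m≤n (Sparse-transpose sparseQ) m<size′
    (meets-every-row (T ∘ swap) (λ missC → ¬sparseT (inj₂ (missR , missC)))))
  where
  m≥2 = ≤-trans (n≤1+n 2) m≥3
  T⊆Q+x′ : T ∘ swap ⊆ᵇ Q ∘ swap ∪[ swap x ]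
  T⊆Q+x′ v Tv = Sum.map₂ (cong swap) (T⊆Q+x (swap v) Tv)
  m<size′ : m < size (T ∘ swap)
  m<size′ = subst (m <_) (sym (size-transpose T)) (≰⇒> (¬sparseT ∘ inj₁))

module _ {K : ℕ} {P R : Region a b} (P⊆R : P ⊆ᵇ R) where

  private
    index : Cell a b → ℕ
    index (i , j) = toℕ (combine i j)

    index-injective : ∀ {u v} → index u ≡ index v → u ≡ v
    index-injective {i , j} {i′ , j′} eq =
      let i≡i′ , j≡j′ = Finₚ.combine-injective i j i′ j′ (Finₚ.toℕ-injective eq) in
      cong₂ _,_ i≡i′ j≡j′

    upto : ℕ → Region a b
    upto r v = P v ∨ (R v ∧ (index v <ᵇ r))

    P⊆upto : ∀ {r} → P ⊆ᵇ upto r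
    P⊆upto v Pv rewrite Pv = refl

    upto⊆R : ∀ {r} → upto r ⊆ᵇ R
    upto⊆R v uv with P v in Pv | R v in Rv
    ... | true  | _     = trans (sym Rv) (P⊆R v Pv)
    ... | false | true  = refl

    upto₀⊆P : upto 0 ⊆ᵇ P
    upto₀⊆P v u₀v with P v | R v
    ... | true  | _     = refl
    ... | false | true  = u₀v
    ... | false | false = u₀v

    R⊆upto-all : R ⊆ᵇ upto (a * b)
    R⊆upto-all v Rv rewrite Rv | <ᵇ-true (Finₚ.toℕ<n (combine (proj₁ v) (proj₂ v))) = ∨-zeroʳ (P v)

    new-index : ∀ {r v} → upto (suc r) v ≡ true → upto r v ≡ false → index v ≡ r
    new-index {r} {v} Tv Qv with P v | R v
    ... | false | true = ≤-antisym (≤-pred (<ᵇ-true⇒< Tv))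
                                   (≮⇒≥ (λ lt → contradiction (trans (sym Qv) (<ᵇ-true lt)) λ ()))

    only-x-new : ∀ {r x} → upto (suc r) x ≡ true → upto r x ≡ false → upto (suc r) ⊆ᵇ upto r ∪[ x ]
    only-x-new {r} Tx Qx v Tv with upto r v in Qv
    ... | true  = inj₁ refl
    ... | false = inj₂ (index-injective (trans (new-index Tv Qv) (sym (new-index Tx Qx))))

  -- Adding the cells of R outside P one at a time, in the order of their index,
  -- sparsity breaks when some single cell is added.
  single-cell-break : Sparse K P → ¬ Sparse K R →
                      ∃₂ λ Q T → ∃ λ x → P ⊆ᵇ T × T ⊆ᵇ R × (T ⊆ᵇ Q ∪[ x ]) ×
                                         Sparse K Q × ¬ Sparse K T
  single-cell-break sparseP ¬sparseR
    with first-failure (λ r → sparse? K (upto r)) (Sparse-mono upto₀⊆P sparseP) (a * b)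
                       (¬sparseR ∘ Sparse-mono R⊆upto-all)
  ... | r , sparse-r , ¬sparse-r+1 with ⊆ᵇ-or-extra (upto (suc r)) (upto r)
  ...   | inj₁ ⊆ = contradiction (Sparse-mono ⊆ sparse-r) ¬sparse-r+1
  ...   | inj₂ (x , Tx , Qx) =
    upto r , upto (suc r) , x , P⊆upto {suc r} , upto⊆R {suc r} , only-x-new Tx Qx , sparse-r , ¬sparse-r+1

-- The strong grid and the game

module _ {m n : ℕ} where
  open Graph (strongGrid m n) using (adj; _≟V_)

  Adjacent⇒adj : {p q : Cell m n} → Adjacent p q → adj p q ≡ true
  Adjacent⇒adj {p} {q} (p≢q , near₁ , near₂) = to T-≡ (from T-∧ (fromWitnessFalse {a? = p ≟V q} p≢q ,
    from T-∧ (≤⇒≤ᵇ (Near⇒∣-∣≤1 _ _ near₁) , ≤⇒≤ᵇ (Near⇒∣-∣≤1 _ _ near₂))))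

  adj⇒Adjacent : {p q : Cell m n} → adj p q ≡ true → Adjacent p q
  adj⇒Adjacent {p} {q} e =
    let ≢ , close = to T-∧ (from T-≡ e)
        close₁ , close₂ = to T-∧ close
    in toWitnessFalse {a? = p ≟V q} ≢ ,
       ∣-∣≤1⇒Near _ _ (≤ᵇ⇒≤ _ _ close₁) ,
       ∣-∣≤1⇒Near _ _ (≤ᵇ⇒≤ _ _ close₂)

module Play (m n k : ℕ) where
  open Game (strongGrid m n) k
  open Graph (strongGrid m n) using (adj; verts; _≟V_)

  private variable s : ℕ

  occupant : (c : Config s) {u : Cell m n} → any (λ i → pos c i == u) (allFin s) ≡ true →
             ∃ λ i → pos c i ≡ u
  occupant {s} c e = let i , eq = any-witness _ (allFin s) e in i , ⌊⌋-true⇒ (pos c i ≟V _) eq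

  occupied : (c : Config s) (i : Fin s) {u : Cell m n} → pos c i ≡ u →
             any (λ i′ → pos c i′ == u) (allFin s) ≡ true
  occupied c i {u} eq = any-allFin (λ i′ → pos c i′ == u) (⌊⌋-true (pos c i ≟V u) eq)

  length-filterᵇ-verts : (p : Region m n) → length (filterᵇ p verts) ≡ size p
  length-filterᵇ-verts p = begin
    length (filterᵇ p (concat (map row (allFin m))))       ≡⟨ cong (λ xs → length (filterᵇ p (concat xs)))
                                                                 (map-tabulate id row) ⟩
    length (filterᵇ p (concat (tabulate row)))             ≡⟨ length-filterᵇ-concat p row ⟩
    sum (λ i → length (filterᵇ p (row i)))                 ≡⟨ sum-cong-≗ (λ i →
                                                                 trans (cong (length ∘ filterᵇ p) (map-tabulate id (i ,_)))
                                                                       (length-filterᵇ-tabulate p (i ,_))) ⟩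
    size p                                                 ∎
    where
    open ≡-Reasoning
    row : Fin m → List (Cell m n)
    row i = map (i ,_) (allFin n)

  UnprotectedNeighbour : Config s → Cell m n → Region m n
  UnprotectedNeighbour c v u = adj v u ∧ not (prot c u)

  MobileOn : (c : Config s) → Cell m n → Fin s → Bool
  MobileOn c v i = (pos c i == v) ∧ mobile c i

  unprotNbrs≡size : (c : Config s) (v : Cell m n) → unprotNbrs c v ≡ size (UnprotectedNeighbour c v)
  unprotNbrs≡size c v = length-filterᵇ-verts _

  mobileOn≡count : (c : Config s) (v : Cell m n) → mobileOn c v ≡ count (MobileOn c v)
  mobileOn≡count c v = length-filterᵇ-tabulate (MobileOn c v) id

  unprotected-neighbour : (c : Config s) {v u : Cell m n} → adj v u ≡ true → prot c u ≡ false →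
                          UnprotectedNeighbour c v u ≡ true
  unprotected-neighbour c vu pu rewrite vu | pu = refl

  unprotected-neighbour⁻ : (c : Config s) {v u : Cell m n} → UnprotectedNeighbour c v u ≡ true →
                           adj v u ≡ true × prot c u ≡ false
  unprotected-neighbour⁻ c {v} {u} e with adj v u | prot c u
  ... | true | false = refl , refl

  mobile-on : (c : Config s) {v : Cell m n} {i : Fin s} → pos c i ≡ v → mobile c i ≡ true →
              MobileOn c v i ≡ true
  mobile-on c {v} {i} at-v mob rewrite ⌊⌋-true (pos c i ≟V v) at-v | mob = refl

  fires-if : (c : Config s) (v : Cell m n) → 1 ≤ unprotNbrs c v → unprotNbrs c v ≤ mobileOn c v →
             fires c v ≡ true
  fires-if c v 1≤U U≤M rewrite ≤ᵇ-true 1≤U | ≤ᵇ-true U≤M = refl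

  fires⇒ : (c : Config s) (v : Cell m n) → fires c v ≡ true → 1 ≤ unprotNbrs c v × unprotNbrs c v ≤ mobileOn c v
  fires⇒ c v e = let 1≤U , U≤M = ∧-true e in ≤ᵇ-true⇒≤ 1≤U , ≤ᵇ-true⇒≤ U≤M

  private
    unprotNbrs≥1 : (c : Config s) {v u : Cell m n} → adj v u ≡ true → prot c u ≡ false →
                   1 ≤ unprotNbrs c v
    unprotNbrs≥1 c {v} {u} vu pu =
      subst (1 ≤_) (sym (unprotNbrs≡size c v))
        (witness⇒1≤size (UnprotectedNeighbour c v) (unprotected-neighbour c {v} {u} vu pu))

    unprotNbrs≤ : (c : Config s) (v : Cell m n) {t : ℕ} (h : Fin t → Cell m n) →
                  (∀ u → adj v u ≡ true → prot c u ≡ false → ∃ λ i → h i ≡ u) → unprotNbrs c v ≤ t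
    unprotNbrs≤ c v h covered = subst (_≤ _) (sym (unprotNbrs≡size c v))
      (size≤image h (UnprotectedNeighbour c v)
        (λ u e → let vu , pu = unprotected-neighbour⁻ c {v} {u} e in covered u vu pu))

  fires-alone : (c : Config s) {v u : Cell m n} {i : Fin s} → pos c i ≡ v → mobile c i ≡ true →
                adj v u ≡ true → prot c u ≡ false →
                (∀ u′ → adj v u′ ≡ true → prot c u′ ≡ false → u′ ≡ u) → fires c v ≡ true
  fires-alone c {v} {u} at-v mob vu pu only-u = fires-if c v (unprotNbrs≥1 c {v} {u} vu pu) (begin
    unprotNbrs c v       ≤⟨ unprotNbrs≤ c v {1} (λ _ → u)
                              (λ u′ vu′ pu′ → zero , sym (only-u u′ vu′ pu′)) ⟩
    1                    ≤⟨ witness⇒1≤count (MobileOn c v) (mobile-on c at-v mob) ⟩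
    count (MobileOn c v) ≡⟨ sym (mobileOn≡count c v) ⟩
    mobileOn c v         ∎)
    where open ≤-Reasoning

  fires-in-pair : (c : Config s) {v u u₁ u₂ : Cell m n} {i i′ : Fin s} → i ≢ i′ →
                  pos c i ≡ v → mobile c i ≡ true → pos c i′ ≡ v → mobile c i′ ≡ true →
                  adj v u ≡ true → prot c u ≡ false →
                  (∀ u′ → adj v u′ ≡ true → prot c u′ ≡ false → u′ ≡ u₁ ⊎ u′ ≡ u₂) →
                  fires c v ≡ true
  fires-in-pair c {v} {u} {u₁} {u₂} i≢i′ at-v mob at-v′ mob′ vu pu among =
    fires-if c v (unprotNbrs≥1 c {v} {u} vu pu) (begin
    unprotNbrs c v       ≤⟨ unprotNbrs≤ c v pair (λ u′ vu′ pu′ → pick (among u′ vu′ pu′)) ⟩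
    2                    ≤⟨ witnesses⇒2≤count (MobileOn c v) i≢i′
                              (mobile-on c at-v mob) (mobile-on c at-v′ mob′) ⟩
    count (MobileOn c v) ≡⟨ sym (mobileOn≡count c v) ⟩
    mobileOn c v         ∎)
    where
    open ≤-Reasoning
    pair : Fin 2 → Cell m n
    pair zero    = u₁
    pair (suc _) = u₂
    pick : ∀ {u′} → u′ ≡ u₁ ⊎ u′ ≡ u₂ → ∃ λ i → pair i ≡ u′
    pick (inj₁ eq) = zero , sym eq
    pick (inj₂ eq) = suc zero , sym eq

  does-not-fire : (c : Config s) {v u₁ u₂ : Cell m n} (i : Fin s) → u₁ ≢ u₂ →
                  adj v u₁ ≡ true → prot c u₁ ≡ false → adj v u₂ ≡ true → prot c u₂ ≡ false →
                  (∀ i′ → pos c i′ ≡ v → i′ ≡ i) → fires c v ≡ false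
  does-not-fire c {v} {u₁} {u₂} i u₁≢u₂ vu₁ pu₁ vu₂ pu₂ alone with fires c v in fires-v
  ... | false = refl
  ... | true  = contradiction (proj₂ (fires⇒ c v fires-v)) (<⇒≱ (begin-strict
    mobileOn c v            ≡⟨ mobileOn≡count c v ⟩
    count (MobileOn c v)    ≤⟨ unique⇒count≤1 (MobileOn c v) i
                                 (λ i′ e → alone i′ (⌊⌋-true⇒ (pos c i′ ≟V v) (proj₁ (∧-true e)))) ⟩
    1                       <⟨ ≤-refl ⟩
    2                       ≤⟨ witnesses⇒2≤size (UnprotectedNeighbour c v) u₁≢u₂
                                 (unprotected-neighbour c {v} {u₁} vu₁ pu₁)
                                 (unprotected-neighbour c {v} {u₂} vu₂ pu₂) ⟩
    size (UnprotectedNeighbour c v) ≡⟨ sym (unprotNbrs≡size c v) ⟩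
    unprotNbrs c v          ∎))
    where open ≤-Reasoning

  surrounded-does-not-fire : (c : Config s) {v : Cell m n} → (∀ u → adj v u ≡ true → prot c u ≡ true) →
                             fires c v ≡ false
  surrounded-does-not-fire c {v} surrounded with fires c v in fires-v
  ... | false = refl
  ... | true  = contradiction (proj₁ (fires⇒ c v fires-v))
                  (<⇒≱ (s≤s (unprotNbrs≤ c v {0} (λ ())
                    (λ u vu pu → contradiction (trans (sym (surrounded u vu)) pu) λ ()))))

  firing-searcher : (c : Config s) {v : Cell m n} → fires c v ≡ true → ∃ λ i → pos c i ≡ v × mobile c i ≡ true
  firing-searcher c {v} fires-v =
    let 1≤U , U≤M = fires⇒ c v fires-v
        i , e = 1≤count⇒witness (MobileOn c v) (subst (1 ≤_) (mobileOn≡count c v) (≤-trans 1≤U U≤M))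
        at-v , mob = ∧-true e
    in i , ⌊⌋-true⇒ (pos c i ≟V v) at-v , mob

  advance : Config s → (Fin s → Cell m n) → Config s
  advance {s} c τ = config pos′ used′ (λ u → prot c u ∨ any (λ i → pos′ i == u) (allFin s))
    where
    pos′  = λ i → if moves c i then τ i else pos c i
    used′ = λ i → if moves c i then suc (used c i) else used c i

  advance-step : (c : Config s) (τ : Fin s → Cell m n) →
                 (∀ i → moves c i ≡ true → adj (pos c i) (τ i) ≡ true × prot c (τ i) ≡ false) →
                 (∀ v u → fires c v ≡ true → adj v u ≡ true → prot c u ≡ false →
                   ∃ λ i → moves c i ≡ true × pos c i ≡ v × τ i ≡ u) →
                 Step c (advance c τ)
  advance-step c τ legal covering = moved , stayed , covered , λ _ → refl
    where
    c′ = advance c τ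
    moved : ∀ i → moves c i ≡ true →
            adj (pos c i) (pos c′ i) ≡ true × prot c (pos c′ i) ≡ false × used c′ i ≡ suc (used c i)
    moved i mv with moves c i | mv | legal i mv
    ... | true | _ | vu , pu = vu , pu , refl
    stayed : ∀ i → moves c i ≡ false → pos c′ i ≡ pos c i × used c′ i ≡ used c i
    stayed i st with moves c i | st
    ... | false | _ = refl , refl
    covered : ∀ v u → fires c v ≡ true → adj v u ≡ true → prot c u ≡ false →
              ∃ λ i → moves c i ≡ true × pos c i ≡ v × pos c′ i ≡ u
    covered v u fv vu pu = let i , mv , at-v , to-u = covering v u fv vu pu in
      i , mv , at-v , trans (cong (if_then τ i else pos c i) mv) to-u

-- The lower bound

module LowerBound (m n k : ℕ) where
  open Game (strongGrid m n) k
  open Graph (strongGrid m n) using (adj)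
  open Play m n k using (occupant; occupied)

  private variable
    s : ℕ
    c c′ : Config s

  protected-after : Step c c′ → ∀ {v} → prot c′ v ≡ true → prot c v ≡ false → ∃ λ i → pos c′ i ≡ v
  protected-after {c = c} {c′ = c′} (_ , _ , _ , prot≡) {v} pv′ pv =
    occupant c′ (trans (sym (cong (_∨ _) pv)) (trans (sym (prot≡ v)) pv′))

  unprotected-after : Step c c′ → ∀ {u} → prot c′ u ≡ false →
                      prot c u ≡ false × ∀ i → pos c′ i ≢ u
  unprotected-after {c′ = c′} (_ , _ , _ , prot≡) {u} pu′ =
    let pu , unoccupied = ∨-false (trans (sym (prot≡ u)) pu′) in
    pu , λ i eq → contradiction (trans (sym (occupied c′ i eq)) unoccupied) λ ()

  protection-grows : Step c c′ → prot c ⊆ᵇ prot c′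
  protection-grows (_ , _ , _ , prot≡) v pv = trans (prot≡ v) (cong (_∨ _) pv)

  Guarded : Config s → Set
  Guarded c = ∀ v u → prot c v ≡ true → adj v u ≡ true → prot c u ≡ false → ∃ λ i → pos c i ≡ v

  guarded-initial : (L : Fin s → Cell m n) → Guarded (initial L)
  guarded-initial L v _ pv _ _ = occupant (initial L) pv

  -- If the guard of v moves, v fires, and firing sends a searcher from v to each
  -- unprotected neighbour.
  guard-stays-or-leaves : Guarded c → Step c c′ → ∀ {v u} → prot c v ≡ true → adj v u ≡ true →
                          prot c u ≡ false →
                          (∃ λ i → pos c′ i ≡ v) ⊎ (∃ λ i → pos c i ≡ v × pos c′ i ≡ u)
  guard-stays-or-leaves {c = c} guarded (_ , stayed , covered , _) {v} {u} pv vu pu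
    with guarded v u pv vu pu
  ... | i , at-v with moves c i in moves-i
  ...   | false = inj₁ (i , trans (proj₁ (stayed i moves-i)) at-v)
  ...   | true  = let fires-v = subst (λ w → fires c w ≡ true) at-v (proj₂ (∧-true {mobile c i} moves-i))
                      i′ , _ , at-v′ , at-u = covered v u fires-v vu pu
                  in inj₂ (i′ , at-v′ , at-u)

  guarded-step : Guarded c → Step c c′ → Guarded c′
  guarded-step {c = c} guarded step v u pv′ vu pu′ with prot c v in pv
  ... | false = protected-after step pv′ pv
  ... | true with unprotected-after step pu′
  ...   | pu , unoccupied with guard-stays-or-leaves guarded step pv vu pu
  ...     | inj₁ stays            = stays
  ...     | inj₂ (i , _ , at-u)   = contradiction at-u (unoccupied i)

  Watches : Config s → Config s → Region m n → Cell m n → Fin s → Set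
  Watches c c′ Q b i = pos c′ i ≡ b ⊎ (pos c i ≡ b × Q (pos c′ i) ≡ false)

  watcher : Guarded c → Step c c′ → (Q : Region m n) → prot c ⊆ᵇ Q → Q ⊆ᵇ prot c′ →
            ∀ {b} → OnBoundary Q b → ∃ (Watches c c′ Q b)
  watcher {c = c} guarded step Q lo hi {b} (Qb , u , b∼u , Qu) with prot c b in pb
  ... | false = map₂ inj₁ (protected-after step (hi b Qb) pb)
  ... | true with guard-stays-or-leaves guarded step pb (Adjacent⇒adj b∼u) (⊆ᵇ-false lo u Qu)
  ...   | inj₁ (i , stays)       = i , inj₁ stays
  ...   | inj₂ (i , at-b , at-u) = i , inj₂ (at-b , trans (cong Q at-u) Qu)

  watches-injective : ∀ {Q b b′ i} → Q b ≡ true → Q b′ ≡ true →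
                      Watches c c′ Q b i → Watches c c′ Q b′ i → b ≡ b′
  watches-injective _  _   (inj₁ at-b)       (inj₁ at-b′)       = trans (sym at-b) at-b′
  watches-injective _  _   (inj₂ (at-b , _)) (inj₂ (at-b′ , _)) = trans (sym at-b) at-b′
  watches-injective {Q = Q} Qb _ (inj₁ at-b) (inj₂ (_ , left)) =
    contradiction (trans (sym Qb) (trans (cong Q (sym at-b)) left)) λ ()
  watches-injective {Q = Q} _ Qb′ (inj₂ (_ , left)) (inj₁ at-b′) =
    contradiction (trans (sym Qb′) (trans (cong Q (sym at-b′)) left)) λ ()

  break-needs-searchers : ∀ {s} {c c′ : Config s} → 3 ≤ m → m ≤ n → Guarded c → Step c c′ →
                          Sparse m (prot c) → ¬ Sparse m (prot c′) → suc m ≤ s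
  break-needs-searchers {s} {c} {c′} m≥3 m≤n guarded step sparse ¬sparse′
    with single-cell-break (protection-grows step) sparse ¬sparse′
  ... | Q , T , x , lo , hi , T⊆Q+x , sparseQ , ¬sparseT
    with boundary-when-sparsity-breaks m≥3 m≤n T⊆Q+x sparseQ ¬sparseT
  ... | f , f-injective , f-boundary = Finₚ.injective⇒≤ g-injective
    where
    g : Fin (suc m) → Fin s
    g i = proj₁ (watcher guarded step T lo hi (f-boundary i))
    g-injective : ∀ {i i′} → g i ≡ g i′ → i ≡ i′
    g-injective {i} {i′} eq = f-injective (watches-injective {c = c} {c′ = c′} {Q = T}
      (proj₁ (f-boundary i)) (proj₁ (f-boundary i′))
      (proj₂ (watcher guarded step T lo hi (f-boundary i)))
      (subst (Watches c c′ T (f i′)) (sym eq) (proj₂ (watcher guarded step T lo hi (f-boundary i′)))))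

  run-break : ∀ {s} {c c′ : Config s} → 3 ≤ m → m ≤ n → Star Step c c′ → Guarded c →
              Sparse m (prot c) → ¬ Sparse m (prot c′) → suc m ≤ s
  run-break _   _   ε                         _       sparse ¬sparse′ = contradiction sparse ¬sparse′
  run-break m≥3 m≤n (_◅_ {j = c₁} step steps) guarded sparse ¬sparse′ with sparse? m (prot c₁)
  ... | yes sparse₁ = run-break m≥3 m≤n steps (guarded-step guarded step) sparse₁ ¬sparse′
  ... | no ¬sparse₁ = break-needs-searchers m≥3 m≤n guarded step sparse ¬sparse₁

  initial-sparse : (L : Fin s → Cell m n) → s ≤ m → Sparse m (prot (initial L))
  initial-sparse L s≤m = inj₁ (≤-trans (size≤image L _ (λ u → occupant (initial L))) s≤m)

  complete-not-sparse : 3 ≤ m → m ≤ n → (T : Region m n) → (∀ v → T v ≡ true) → ¬ Sparse m T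
  complete-not-sparse m≥3 m≤n T all (inj₂ ((i , row-i) , _)) =
    contradiction (trans (sym (all (i , j₀))) (row-i j₀)) λ ()
    where j₀ = fromℕ< (≤-trans (s≤s z≤n) (≤-trans m≥3 m≤n))
  complete-not-sparse m≥3 m≤n T all (inj₁ size≤m) = contradiction (≤-trans m<size size≤m) (<-irrefl refl)
    where
    m<size : m < size T
    m<size = begin-strict
      m                      <⟨ m<m+n m (≤-trans (s≤s z≤n) m≥3) ⟩
      m + m                  ≡⟨ cong (m +_) (sym (+-identityʳ m)) ⟩
      2 * m                  ≡⟨ *-comm 2 m ⟩
      m * 2                  ≤⟨ *-monoʳ-≤ m (≤-trans (n≤1+n 2) (≤-trans m≥3 m≤n)) ⟩
      m * n                  ≡⟨ sym (sum-const m n) ⟩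
      sum {m} (λ _ → n)      ≡⟨ sum-cong-≗ (λ i → sym (count-all _ (λ j → all (i , j)))) ⟩
      size T                 ∎
      where open ≤-Reasoning

  lowerBound : 3 ≤ m → m ≤ n → ∀ s (L : Fin s → Cell m n) → Successful L → suc m ≤ s
  lowerBound m≥3 m≤n s L (final , run , complete) with suc m ≤? s
  ... | yes m<s = m<s
  ... | no  m≮s = run-break m≥3 m≤n run (guarded-initial L) (initial-sparse L (≤-pred (≰⇒> m≮s)))
                    (complete-not-sparse m≥3 m≤n (prot final) complete)

-- The upper bound: sweeping the grid column by column

-- Junk value zero beyond N.
toFin : ∀ {N} → ℕ → Fin (suc N)
toFin {N} x with x <? suc N
... | yes x<1+N = fromℕ< x<1+N
... | no  _     = zero

toℕ-toFin : ∀ {N} x → x ≤ N → toℕ (toFin {N} x) ≡ x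
toℕ-toFin {N} x x≤N with x <? suc N
... | yes x<1+N = Finₚ.toℕ-fromℕ< x<1+N
... | no  x≮1+N = contradiction (s≤s x≤N) x≮1+N

-- The searchers of the sweep, by the move they make while the sweep passes from one
-- column to the next: diagonal r goes from row r to row r + 1, straight false (the
-- second searcher of row 0) stays in row 0 and straight true in the last row M.
-- Phases consist of M stages, and stage ρ is the one in which ρ moves.
data Role : Set where
  diagonal : ℕ → Role
  straight : Bool → Role

module Roles (M : ℕ) (2≤M : 2 ≤ M) where

  Valid : Role → Set
  Valid (diagonal r) = r < M
  Valid (straight _) = ⊤

  source : Role → ℕ
  source (diagonal r)     = r
  source (straight false) = 0
  source (straight true)  = M

  target : Role → ℕ
  target (diagonal r) = suc r
  target (straight b) = source (straight b)

  stage : Role → ℕ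
  stage (diagonal r)     = suc r
  stage (straight false) = 1
  stage (straight true)  = M

  reflect : Role → Role
  reflect (diagonal r) = diagonal (M ∸ suc r)
  reflect (straight b) = straight (not b)

  private variable
    q : ℕ

  stage≥1 : ∀ ρ → 1 ≤ stage ρ
  stage≥1 (diagonal r)     = s≤s z≤n
  stage≥1 (straight false) = ≤-refl
  stage≥1 (straight true)  = ≤-trans (n≤1+n 1) 2≤M

  stage≤M : ∀ ρ → Valid ρ → stage ρ ≤ M
  stage≤M (diagonal r)     r<M = r<M
  stage≤M (straight false) _   = ≤-trans (n≤1+n 1) 2≤M
  stage≤M (straight true)  _   = ≤-refl

  target≤stage : ∀ ρ → target ρ ≤ stage ρ
  target≤stage (diagonal r)     = ≤-refl
  target≤stage (straight false) = z≤n
  target≤stage (straight true)  = ≤-refl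

  target≤M : ∀ ρ → Valid ρ → target ρ ≤ M
  target≤M ρ valid = ≤-trans (target≤stage ρ) (stage≤M ρ valid)

  source≤M : ∀ ρ → Valid ρ → source ρ ≤ M
  source≤M (diagonal r)     r<M = <⇒≤ r<M
  source≤M (straight false) _   = z≤n
  source≤M (straight true)  _   = ≤-refl

  source-near-target : ∀ ρ → Near (source ρ) (target ρ)
  source-near-target (diagonal r) = Near-suc r
  source-near-target (straight b) = Near-refl _

  active-target-fresh : ∀ ρ → stage ρ ≡ suc q → q ≡ 0 ⊎ q < target ρ
  active-target-fresh (diagonal r)     refl = inj₂ ≤-refl
  active-target-fresh (straight false) refl = inj₁ refl
  active-target-fresh (straight true)  eq   = inj₂ (≤-reflexive (sym eq))

  active-reach : ∀ ρ → stage ρ ≡ suc q → ∀ r → r ≤ M → Near (source ρ) r → r ≤ suc q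
  active-reach (diagonal r)     refl _ _   near = proj₂ near
  active-reach (straight false) refl _ _   near = proj₂ near
  active-reach (straight true)  eq   _ r≤M _    = subst (_ ≤_) eq r≤M

  -- Here 2 ≤ M matters: the searcher of the last row must not move in the first stage.
  active-first : ∀ ρ → stage ρ ≡ 1 → source ρ ≡ 0
  active-first (diagonal zero)  _  = refl
  active-first (straight false) _  = refl
  active-first (straight true)  eq = contradiction (subst (2 ≤_) eq 2≤M) λ { (s≤s ()) }

  waiting-source : ∀ ρ → suc q < stage ρ → q < source ρ
  waiting-source (diagonal r)    (s≤s q<r) = q<r
  waiting-source (straight true) q+1<M     = <-trans (n<1+n _) q+1<M
  waiting-source (straight false) (s≤s ())

  waiting-second-row : ∀ ρ → Valid ρ → suc q < stage ρ →
                       ∃ λ r → q < r × r ≤ M × r ≢ source ρ × Near (source ρ) r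
  waiting-second-row (diagonal r) r<M (s≤s q<r) =
    suc r , m<n⇒m<1+n q<r , r<M , 1+n≢n , Near-suc r
  waiting-second-row (straight true) _ q+1<M = pred M , below-last q+1<M
    where
    below-last : ∀ {x N} → suc x < N → x < pred N × pred N ≤ N × pred N ≢ N × Near N (pred N)
    below-last {N = suc N} (s≤s x<N) = x<N , n≤1+n N , <⇒≢ (n<1+n N) , Near-sym (Near-suc N)
  waiting-second-row (straight false) _ (s≤s ())

  source-injective : ∀ ρ ρ′ → Valid ρ → Valid ρ′ → 1 ≤ source ρ → source ρ ≡ source ρ′ → ρ ≡ ρ′
  source-injective (diagonal r)    (diagonal r′)     _   _    _  eq = cong diagonal eq
  source-injective (diagonal r)    (straight false)  _   _    1≤ eq = contradiction (subst (1 ≤_) eq 1≤) λ ()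
  source-injective (diagonal r)    (straight true)   r<M _    _  eq = contradiction eq (<⇒≢ r<M)
  source-injective (straight true) (diagonal r′)     _   r′<M _  eq = contradiction (sym eq) (<⇒≢ r′<M)
  source-injective (straight true) (straight false)  _   _    1≤ eq = contradiction (subst (1 ≤_) eq 1≤) λ ()
  source-injective (straight true) (straight true)   _   _    _  _  = refl

  target-injective : ∀ ρ ρ′ → stage ρ < M → stage ρ′ < M → target ρ ≡ target ρ′ → ρ ≡ ρ′
  target-injective (diagonal r)     (diagonal r′)     _   _    eq = cong diagonal (suc-injective eq)
  target-injective (straight false) (straight false)  _   _    _  = refl
  target-injective (straight true)  _                 M<M _    _  = contradiction M<M (<-irrefl refl)
  target-injective _                (straight true)   _   M<M  _  = contradiction M<M (<-irrefl refl)
  target-injective (diagonal r)     (straight false)  _   _    ()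
  target-injective (straight false) (diagonal r′)     _   _    ()

  reflect-valid : ∀ ρ → Valid ρ → Valid (reflect ρ)
  reflect-valid (diagonal r) r<M = ∸-monoʳ-< (s≤s z≤n) r<M
  reflect-valid (straight b) _   = tt

  reflect-involutive : ∀ ρ → Valid ρ → reflect (reflect ρ) ≡ ρ
  reflect-involutive (diagonal r) r<M = cong diagonal (begin
    M ∸ suc (M ∸ suc r)   ≡⟨ cong (M ∸_) (sym (+-∸-assoc 1 r<M)) ⟩
    M ∸ (M ∸ r)           ≡⟨ m∸[m∸n]≡n (<⇒≤ r<M) ⟩
    r                     ∎)
    where open ≡-Reasoning
  reflect-involutive (straight b) _ = cong straight (not-involutive b)

  -- After the sweep reaches the next column the rows are counted from the other end.
  reflect-source : ∀ ρ → M ∸ target ρ ≡ source (reflect ρ)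
  reflect-source (diagonal r)     = refl
  reflect-source (straight false) = refl
  reflect-source (straight true)  = n∸n≡0 M

  role : Fin (suc (suc M)) → Role
  role zero          = straight false
  role (suc zero)    = straight true
  role (suc (suc r)) = diagonal (toℕ r)

  role-valid : ∀ i → Valid (role i)
  role-valid zero          = tt
  role-valid (suc zero)    = tt
  role-valid (suc (suc r)) = Finₚ.toℕ<n r

  role-injective : ∀ {i i′} → role i ≡ role i′ → i ≡ i′
  role-injective {zero}        {zero}         _  = refl
  role-injective {suc zero}    {suc zero}     _  = refl
  role-injective {suc (suc r)} {suc (suc r′)} eq =
    cong (λ x → suc (suc x)) (Finₚ.toℕ-injective (diagonal-injective eq))
    where
    diagonal-injective : ∀ {x y} → diagonal x ≡ diagonal y → x ≡ y
    diagonal-injective refl = refl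
  role-injective {zero}        {suc zero}     ()
  role-injective {zero}        {suc (suc _)}  ()
  role-injective {suc zero}    {zero}         ()
  role-injective {suc zero}    {suc (suc _)}  ()
  role-injective {suc (suc _)} {zero}         ()
  role-injective {suc (suc _)} {suc zero}     ()

  role-onto : ∀ ρ → Valid ρ → ∃ λ i → role i ≡ ρ
  role-onto (diagonal r)     r<M = suc (suc (fromℕ< r<M)) , cong diagonal (Finₚ.toℕ-fromℕ< r<M)
  role-onto (straight false) _   = zero , refl
  role-onto (straight true)  _   = suc zero , refl

  source-onto : ∀ r → r ≤ M → ∃ λ ρ → Valid ρ × source ρ ≡ r
  source-onto r r≤M with r <? M
  ... | yes r<M = diagonal r , r<M , refl
  ... | no  r≮M = straight true , tt , ≤-antisym (≮⇒≥ r≮M) r≤M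

module Sweep (M N k : ℕ) (2≤M : 2 ≤ M) (N≤k : N ≤ k) where

  m s : ℕ
  m = suc M
  s = suc m

  open Game (strongGrid m (suc N)) k
  open Graph (strongGrid m (suc N)) using (adj)
  open Play m (suc N) k
  open Roles M 2≤M

  flip : Bool → Fin m → Fin m
  flip false i = i
  flip true  i = opposite i

  flip-involutive : ∀ d i → flip d (flip d i) ≡ i
  flip-involutive false i = refl
  flip-involutive true  i = Finₚ.opposite-involutive i

  -- Rows are counted in the direction d, from the end where the current column holds
  -- two searchers.
  row : Bool → Cell m (suc N) → ℕ
  row d v = toℕ (flip d (proj₁ v))

  col : Cell m (suc N) → ℕ
  col v = toℕ (proj₂ v)

  row≤M : ∀ d v → row d v ≤ M
  row≤M d v = ≤-pred (Finₚ.toℕ<n _)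

  col≤N : ∀ v → col v ≤ N
  col≤N v = ≤-pred (Finₚ.toℕ<n _)

  row-not : ∀ d v → row (not d) v ≡ M ∸ row d v
  row-not false v = Finₚ.opposite-prop (proj₁ v)
  row-not true  v = sym (trans (cong (M ∸_) (Finₚ.opposite-prop (proj₁ v))) (m∸[m∸n]≡n (row≤M false v)))

  Near-rows : ∀ d {u v} → Near (toℕ (proj₁ u)) (toℕ (proj₁ v)) → Near (row d u) (row d v)
  Near-rows false near = near
  Near-rows true {u} {v} near rewrite Finₚ.opposite-prop (proj₁ u) | Finₚ.opposite-prop (proj₁ v) =
    Near-∸ M (row≤M false u) (row≤M false v) near

  Near-rows⁻ : ∀ d {u v} → Near (row d u) (row d v) → Near (toℕ (proj₁ u)) (toℕ (proj₁ v))
  Near-rows⁻ false near = near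
  Near-rows⁻ true {u} {v} near =
    subst₂ Near (sym (row-not true u)) (sym (row-not true v)) (Near-∸ M (row≤M true u) (row≤M true v) near)


  at : Bool → ℕ → ℕ → Cell m (suc N)
  at d r c = flip d (toFin r) , toFin c

  row-at : ∀ d {r} c → r ≤ M → row d (at d r c) ≡ r
  row-at d c r≤M = trans (cong toℕ (flip-involutive d _)) (toℕ-toFin _ r≤M)

  col-at : ∀ d r {c} → c ≤ N → col (at d r c) ≡ c
  col-at d r c≤N = toℕ-toFin _ c≤N

  at-unique : ∀ d v {r c} → row d v ≡ r → col v ≡ c → v ≡ at d r c
  at-unique d (i , j) refl refl = cong₂ _,_
    (trans (sym (flip-involutive d i)) (cong (flip d) (sym (toFin-toℕ (flip d i)))))
    (sym (toFin-toℕ j))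
    where
    toFin-toℕ : ∀ {N} (x : Fin (suc N)) → toFin (toℕ x) ≡ x
    toFin-toℕ x = Finₚ.toℕ-injective (toℕ-toFin (toℕ x) (≤-pred (Finₚ.toℕ<n x)))

  adj-across : ∀ d {u v} → col v ≡ suc (col u) → Near (row d u) (row d v) → adj u v ≡ true
  adj-across d {u} {v} next-col near = Adjacent⇒adj {m} {suc N}
    ( (λ u≡v → 1+n≢n (trans (sym next-col) (cong col (sym u≡v))))
    , Near-rows⁻ d {u} {v} near
    , subst (Near (col u)) (sym next-col) (Near-suc (col u)))

  adj-down : ∀ d {u v} → col u ≡ col v → row d v ≡ suc (row d u) → adj u v ≡ true
  adj-down d {u} {v} same-col next-row = Adjacent⇒adj {m} {suc N}
    ( (λ u≡v → 1+n≢n (trans (sym next-row) (cong (row d) (sym u≡v))))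
    , Near-rows⁻ d {u} {v} (subst (Near (row d u)) (sym next-row) (Near-suc (row d u)))
    , subst (Near (col u)) same-col (Near-refl (col u)))

  adj⇒near : ∀ d {u v} → adj u v ≡ true → Near (row d u) (row d v) × Near (col u) (col v)
  adj⇒near d {u} {v} e = let _ , near-rows , near-cols = adj⇒Adjacent {m} {suc N} e in
                         Near-rows d {u} {v} near-rows , near-cols

  -- While the sweep passes from column j to column j + 1, after q stages.
  Protected : Bool → ℕ → ℕ → Cell m (suc N) → Set
  Protected d j q v = col v ≤ j ⊎ (col v ≡ suc j × row d v ≤ q × 1 ≤ q)

  data Position (j : ℕ) : Set where
    interior : suc (suc j) ≤ N → Position j
    final    : suc j ≡ N → Position j

  -- Where the searchers that already moved in this phase stand. In the last column they
  -- may move again, down the column, so only their column and a bound on their row are kept.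
  Landed : ∀ {j} → Position j → Bool → ℕ → Role → Cell m (suc N) → ℕ → Set
  Landed {j} (interior _) d q ρ v u = row d v ≡ target ρ × col v ≡ suc j × u ≡ suc j
  Landed {j} (final _)    d q ρ v u = col v ≡ suc j × row d v ≤ q

  record Sweeping (d : Bool) (j q : ℕ) (c : Config s) : Set where
    field
      position       : Position j
      slot           : Fin s → Role
      slot-valid     : ∀ i → Valid (slot i)
      slot-injective : ∀ {i i′} → slot i ≡ slot i′ → i ≡ i′
      slot-onto      : ∀ ρ → Valid ρ → ∃ λ i → slot i ≡ ρ
      protected      : ∀ v → prot c v ≡ true ⇔ Protected d j q v
      waiting        : ∀ i → q < stage (slot i) →
                       row d (pos c i) ≡ source (slot i) × col (pos c i) ≡ j × used c i ≡ j
      landed         : ∀ i → stage (slot i) ≤ q → Landed position d q (slot i) (pos c i) (used c i)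

  Protected-mono : ∀ {d j q v} → Protected d j q v → Protected d j (suc q) v
  Protected-mono (inj₁ col≤j)                     = inj₁ col≤j
  Protected-mono (inj₂ (col≡ , row≤q , _))        = inj₂ (col≡ , m≤n⇒m≤1+n row≤q , s≤s z≤n)

  module Stage {d : Bool} {j q : ℕ} {c : Config s} (I : Sweeping d j q c) (q<M : q < M) where
    open Sweeping I

    j<N : j < N
    j<N with position
    ... | interior j+2≤N = ≤-trans (n≤1+n _) j+2≤N
    ... | final    j+1≡N = ≤-reflexive j+1≡N

    mobile-at : ∀ i → used c i ≡ j → mobile c i ≡ true
    mobile-at i used≡j = <ᵇ-true (subst (_< k) (sym used≡j) (<-≤-trans j<N N≤k))

    next : ℕ → Cell m (suc N)
    next r = at d r (suc j)

    row-next : ∀ {r} → r ≤ M → row d (next r) ≡ r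
    row-next = row-at d (suc j)

    col-next : ∀ r → col (next r) ≡ suc j
    col-next r = col-at d r j<N

    unprotected : ∀ {v} → ¬ Protected d j q v → prot c v ≡ false
    unprotected ¬P = ¬-not (¬P ∘ to (protected _))

    unprotected⁻ : ∀ {v} → prot c v ≡ false → ¬ Protected d j q v
    unprotected⁻ pv P = contradiction (trans (sym pv) (from (protected _) P)) λ ()

    fresh : ∀ {r} → q ≡ 0 ⊎ q < r → r ≤ M → prot c (next r) ≡ false
    fresh {r} q≡0⊎q<r r≤M = unprotected λ
      { (inj₁ col≤j)               → 1+n≰n (subst (_≤ j) (col-next r) col≤j)
      ; (inj₂ (_ , row≤q , 1≤q)) → case q≡0⊎q<r (subst (_≤ q) (row-next r≤M) row≤q) 1≤q }
      where
      case : q ≡ 0 ⊎ q < r → r ≤ q → 1 ≤ q → ⊥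
      case (inj₁ refl) _   ()
      case (inj₂ q<r)  r≤q _ = <⇒≱ q<r r≤q

    unprotected-col : ∀ {u} → prot c u ≡ false → col u ≤ suc j → col u ≡ suc j × ¬ (row d u ≤ q × 1 ≤ q)
    unprotected-col pu col≤1+j = col≡ , λ (row≤q , 1≤q) → unprotected⁻ pu (inj₂ (col≡ , row≤q , 1≤q))
      where col≡ = ≤-antisym col≤1+j (≰⇒> (unprotected⁻ pu ∘ inj₁))

    landed-interior : ∀ {h} → position ≡ interior h → ∀ i → stage (slot i) ≤ q →
                      row d (pos c i) ≡ target (slot i) × col (pos c i) ≡ suc j × used c i ≡ suc j
    landed-interior pos≡ i le = subst (λ p → Landed p d q (slot i) (pos c i) (used c i)) pos≡ (landed i le)

    landed-final : ∀ {h} → position ≡ final h → ∀ i → stage (slot i) ≤ q →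
                   col (pos c i) ≡ suc j × row d (pos c i) ≤ q
    landed-final pos≡ i le = subst (λ p → Landed p d q (slot i) (pos c i) (used c i)) pos≡ (landed i le)

    landed-col : ∀ i → stage (slot i) ≤ q → col (pos c i) ≡ suc j
    landed-col i le with position in pos≡
    ... | interior _ = proj₁ (proj₂ (landed-interior pos≡ i le))
    ... | final    _ = proj₁ (landed-final pos≡ i le)

    on-protected : ∀ i → Protected d j q (pos c i)
    on-protected i with stage (slot i) ≤? q
    ... | no  ≰q = inj₁ (≤-reflexive (proj₁ (proj₂ (waiting i (≰⇒> ≰q)))))
    ... | yes ≤q with position in pos≡
    ...   | interior _ = let row≡ , col≡ , _ = landed-interior pos≡ i ≤q in
                         inj₂ (col≡ , ≤-trans (≤-reflexive row≡) (≤-trans (target≤stage _) ≤q) , 1≤q)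
      where 1≤q = ≤-trans (stage≥1 (slot i)) ≤q
    ...   | final    _ = let col≡ , row≤q = landed-final pos≡ i ≤q in
                         inj₂ (col≡ , row≤q , ≤-trans (stage≥1 (slot i)) ≤q)

    data Status (i : Fin s) : Set where
      done    : stage (slot i) ≤ q → Status i
      active  : stage (slot i) ≡ suc q → Status i
      pending : suc q < stage (slot i) → Status i

    status : ∀ i → Status i
    status i with stage (slot i) ≤? q
    ... | yes ≤q = done ≤q
    ... | no  ≰q with stage (slot i) ≟ suc q
    ...   | yes ≡suc = active ≡suc
    ...   | no  ≢suc = pending (≤∧≢⇒< (≰⇒> ≰q) (≢suc ∘ sym))

    module Active {i : Fin s} (act : stage (slot i) ≡ suc q) where

      private
        ρ = slot i
        at-source = waiting i (≤-reflexive (sym act))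

      row-i : row d (pos c i) ≡ source ρ
      row-i = proj₁ at-source

      col-i : col (pos c i) ≡ j
      col-i = proj₁ (proj₂ at-source)

      used-i : used c i ≡ j
      used-i = proj₂ (proj₂ at-source)

      destination : Cell m (suc N)
      destination = next (target ρ)

      to-destination : adj (pos c i) destination ≡ true
      to-destination = adj-across d {pos c i} {destination} (trans (col-next (target ρ)) (cong suc (sym col-i)))
        (subst₂ Near (sym row-i) (sym (row-next (target≤M ρ (slot-valid i)))) (source-near-target ρ))

      destination-fresh : prot c destination ≡ false
      destination-fresh = fresh (active-target-fresh ρ act) (target≤M ρ (slot-valid i))

      neighbour-col : ∀ {u} → adj (pos c i) u ≡ true → prot c u ≡ false →
                      col u ≡ suc j × ¬ (row d u ≤ q × 1 ≤ q)
      neighbour-col {u} vu pu =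
        unprotected-col pu (subst (λ x → col u ≤ suc x) col-i (proj₂ (proj₂ (adj⇒near d {pos c i} {u} vu))))

      neighbour-row : ∀ {u} → adj (pos c i) u ≡ true → row d u ≤ suc q
      neighbour-row {u} vu =
        active-reach ρ act (row d u) (row≤M d u)
          (subst (λ x → Near x (row d u)) row-i (proj₁ (adj⇒near d {pos c i} {u} vu)))

      neighbours : ∀ {u} → adj (pos c i) u ≡ true → prot c u ≡ false →
                   (q ≡ 0 × u ≡ next 0) ⊎ u ≡ next (suc q)
      neighbours {u} vu pu with row d u ≟ suc q | 1 ≤? q
      ... | yes row≡ | _       = inj₂ (at-unique d u row≡ (proj₁ (neighbour-col vu pu)))
      ... | no  row≢ | yes 1≤q =
        contradiction (≤-pred (≤∧≢⇒< (neighbour-row vu) row≢) , 1≤q) (proj₂ (neighbour-col vu pu))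
      ... | no  row≢ | no  1≰q =
        let q≡0 = n<1⇒n≡0 (≰⇒> 1≰q)
            row≤q = ≤-pred (≤∧≢⇒< (neighbour-row vu) row≢)
        in inj₁ (q≡0 , at-unique d u (n≤0⇒n≡0 (subst (row d u ≤_) q≡0 row≤q)) (proj₁ (neighbour-col vu pu)))

    open Active using (destination; to-destination; destination-fresh)

    active-target : ∀ {i} → stage (slot i) ≡ suc q → 1 ≤ q → target (slot i) ≡ suc q
    active-target {i} act 1≤q with active-target-fresh (slot i) act
    ... | inj₁ refl = contradiction 1≤q λ ()
    ... | inj₂ q<t  = ≤-antisym (subst (target (slot i) ≤_) act (target≤stage (slot i))) q<t

    module FirstStage (q≡0 : q ≡ 0) where

      at-start : ∀ {i} → stage (slot i) ≡ suc q → pos c i ≡ at d 0 j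
      at-start {i} act = at-unique d (pos c i)
        (trans (Active.row-i act) (active-first (slot i) (trans act (cong suc q≡0)))) (Active.col-i act)

      diagonal₀ straight₀ : Fin s
      diagonal₀ = proj₁ (slot-onto (diagonal 0) (≤-trans (s≤s z≤n) 2≤M))
      straight₀ = proj₁ (slot-onto (straight false) tt)

      slot-diagonal₀ : slot diagonal₀ ≡ diagonal 0
      slot-diagonal₀ = proj₂ (slot-onto (diagonal 0) (≤-trans (s≤s z≤n) 2≤M))

      slot-straight₀ : slot straight₀ ≡ straight false
      slot-straight₀ = proj₂ (slot-onto (straight false) tt)

      diagonal₀-active : stage (slot diagonal₀) ≡ suc q
      diagonal₀-active = trans (cong stage slot-diagonal₀) (cong suc (sym q≡0))

      straight₀-active : stage (slot straight₀) ≡ suc q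
      straight₀-active = trans (cong stage slot-straight₀) (cong suc (sym q≡0))

      diagonal₀≢straight₀ : diagonal₀ ≢ straight₀
      diagonal₀≢straight₀ eq =
        contradiction (trans (sym slot-diagonal₀) (trans (cong slot eq) slot-straight₀)) λ ()

      destination-diagonal₀ : destination diagonal₀-active ≡ next (suc q)
      destination-diagonal₀ = cong next (trans (cong target slot-diagonal₀) (cong suc (sym q≡0)))

      destination-straight₀ : destination straight₀-active ≡ next 0
      destination-straight₀ = cong next (cong target slot-straight₀)

    active-fires : ∀ {i} → stage (slot i) ≡ suc q → fires c (pos c i) ≡ true
    active-fires {i} act with 1 ≤? q
    ... | yes 1≤q =
      fires-alone c refl (mobile-at i (Active.used-i act)) (to-destination act) (destination-fresh act) only
      where
      only : ∀ u → adj (pos c i) u ≡ true → prot c u ≡ false → u ≡ destination act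
      only u vu pu with Active.neighbours act vu pu
      ... | inj₁ (q≡0 , _) = contradiction (subst (1 ≤_) q≡0 1≤q) λ ()
      ... | inj₂ u≡next    = trans u≡next (cong next (sym (active-target act 1≤q)))
    ... | no  1≰q = fires-in-pair c diagonal₀≢straight₀
      (trans (at-start diagonal₀-active) (sym (at-start act))) (mobile-at _ (Active.used-i diagonal₀-active))
      (trans (at-start straight₀-active) (sym (at-start act))) (mobile-at _ (Active.used-i straight₀-active))
      (to-destination act) (destination-fresh act) among
      where
      open FirstStage (n<1⇒n≡0 (≰⇒> 1≰q))
      among : ∀ u → adj (pos c i) u ≡ true → prot c u ≡ false → u ≡ next 0 ⊎ u ≡ next (suc q)
      among u vu pu with Active.neighbours act vu pu
      ... | inj₁ (_ , u≡next₀) = inj₁ u≡next₀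
      ... | inj₂ u≡next        = inj₂ u≡next

    active-covers : ∀ {i u} (act : stage (slot i) ≡ suc q) → adj (pos c i) u ≡ true → prot c u ≡ false →
                    ∃ λ i′ → Σ (stage (slot i′) ≡ suc q) λ act′ →
                             pos c i′ ≡ pos c i × destination act′ ≡ u
    active-covers {i} {u} act vu pu with Active.neighbours act vu pu | 1 ≤? q
    ... | inj₂ u≡next    | yes 1≤q = i , act , refl , trans (cong next (active-target act 1≤q)) (sym u≡next)
    ... | inj₂ u≡next    | no  1≰q = let open FirstStage (n<1⇒n≡0 (≰⇒> 1≰q)) in
      diagonal₀ , diagonal₀-active , trans (at-start diagonal₀-active) (sym (at-start act)) ,
      trans destination-diagonal₀ (sym u≡next)
    ... | inj₁ (q≡0 , u≡next₀) | _ = let open FirstStage q≡0 in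
      straight₀ , straight₀-active , trans (at-start straight₀-active) (sym (at-start act)) ,
      trans destination-straight₀ (sym u≡next₀)

    pending-still : ∀ {i} → suc q < stage (slot i) → fires c (pos c i) ≡ false
    pending-still {i} pend = does-not-fire c {pos c i} {u₁} {u₂} i u₁≢u₂
      (adj-across d {pos c i} {u₁} (col-next₁ (source ρ))
        (subst₂ Near (sym row-i) (sym (row-next src≤M)) (Near-refl _)))
      (fresh (inj₂ q<src) src≤M)
      (adj-across d {pos c i} {u₂} (col-next₁ r) (subst₂ Near (sym row-i) (sym (row-next r≤M)) near))
      (fresh (inj₂ q<r) r≤M)
      alone
      where
      ρ = slot i
      row-i = proj₁ (waiting i (<⇒≤ pend))
      col-i = proj₁ (proj₂ (waiting i (<⇒≤ pend)))
      src≤M = source≤M ρ (slot-valid i)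
      q<src = waiting-source ρ pend
      second = waiting-second-row ρ (slot-valid i) pend
      r = proj₁ second
      q<r = proj₁ (proj₂ second)
      r≤M = proj₁ (proj₂ (proj₂ second))
      near = proj₂ (proj₂ (proj₂ (proj₂ second)))
      u₁ = next (source ρ)
      u₂ = next r
      col-next₁ : ∀ r → col (next r) ≡ suc (col (pos c i))
      col-next₁ r = trans (col-next r) (cong suc (sym col-i))
      u₁≢u₂ : u₁ ≢ u₂
      u₁≢u₂ eq = proj₁ (proj₂ (proj₂ (proj₂ second)))
        (trans (sym (row-next r≤M)) (trans (cong (row d) (sym eq)) (row-next src≤M)))
      alone : ∀ i′ → pos c i′ ≡ pos c i → i′ ≡ i
      alone i′ same with stage (slot i′) ≤? q
      ... | yes ≤q = contradiction (trans (sym (landed-col i′ ≤q)) (trans (cong col same) col-i)) 1+n≢n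
      ... | no  ≰q = slot-injective (source-injective (slot i′) ρ (slot-valid i′) (slot-valid i)
                       (subst (1 ≤_) (sym src≡) (≤-trans (s≤s z≤n) q<src)) src≡)
        where
        src≡ : source (slot i′) ≡ source ρ
        src≡ = trans (sym (proj₁ (waiting i′ (≰⇒> ≰q)))) (trans (cong (row d) same) row-i)

    beyond-fresh : ∀ {v} → suc j < col v → prot c v ≡ false
    beyond-fresh {v} j+1<col = unprotected λ
      { (inj₁ col≤j)        → <⇒≱ j+1<col (m≤n⇒m≤1+n col≤j)
      ; (inj₂ (col≡ , _)) → <-irrefl (sym col≡) j+1<col }

    interior-done-still : ∀ {h} → position ≡ interior h → ∀ {i} → stage (slot i) ≤ q →
                          fires c (pos c i) ≡ false
    interior-done-still {h} pos≡ {i} ≤q = does-not-fire c {pos c i} {u₁} {u₂} i u₁≢u₂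
      (adj-across d {pos c i} {u₁} (col-far (target ρ))
        (subst₂ Near (sym row-i) (sym (row-at d (suc (suc j)) t≤M)) (Near-refl _)))
      (beyond-fresh {u₁} (≤-reflexive (sym (col-at d (target ρ) h))))
      (adj-across d {pos c i} {u₂} (col-far (suc (target ρ)))
        (subst₂ Near (sym row-i) (sym (row-at d (suc (suc j)) t<M)) (Near-suc _)))
      (beyond-fresh {u₂} (≤-reflexive (sym (col-at d (suc (target ρ)) h))))
      alone
      where
      ρ = slot i
      row-i = proj₁ (landed-interior pos≡ i ≤q)
      col-i = proj₁ (proj₂ (landed-interior pos≡ i ≤q))
      t<M : target ρ < M
      t<M = ≤-<-trans (≤-trans (target≤stage ρ) ≤q) q<M
      t≤M = <⇒≤ t<M
      u₁ = at d (target ρ) (suc (suc j))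
      u₂ = at d (suc (target ρ)) (suc (suc j))
      col-far : ∀ r → col (at d r (suc (suc j))) ≡ suc (col (pos c i))
      col-far r = trans (col-at d r h) (cong suc (sym col-i))
      u₁≢u₂ : u₁ ≢ u₂
      u₁≢u₂ eq = 1+n≢n (trans (sym (row-at d (suc (suc j)) t<M))
                              (trans (cong (row d) (sym eq)) (row-at d (suc (suc j)) t≤M)))
      alone : ∀ i′ → pos c i′ ≡ pos c i → i′ ≡ i
      alone i′ same with stage (slot i′) ≤? q
      ... | no  ≰q =
        contradiction (trans (sym col-i) (trans (cong col (sym same)) (proj₁ (proj₂ (waiting i′ (≰⇒> ≰q)))))) 1+n≢n
      ... | yes ≤q′ = slot-injective (target-injective (slot i′) ρ (≤-<-trans ≤q′ q<M) (≤-<-trans ≤q q<M)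
                        (trans (sym (proj₁ (landed-interior pos≡ i′ ≤q′))) (trans (cong (row d) same) row-i)))

    module FinalDone {h} (pos≡ : position ≡ final h) {i} (≤q : stage (slot i) ≤ q) where

      private
        col-i = proj₁ (landed-final pos≡ i ≤q)
        1≤q = ≤-trans (stage≥1 (slot i)) ≤q
        col≤1+j : ∀ u → col u ≤ suc j
        col≤1+j u = subst (col u ≤_) (sym h) (col≤N u)

      firing-row : fires c (pos c i) ≡ true → row d (pos c i) ≡ q
      firing-row fires-i with row d (pos c i) <? q
      ... | no  ≮q  = ≤-antisym (proj₂ (landed-final pos≡ i ≤q)) (≮⇒≥ ≮q)
      ... | yes row<q =
        contradiction (trans (sym fires-i) (surrounded-does-not-fire c {pos c i} surrounded)) λ ()
        where
        surrounded : ∀ u → adj (pos c i) u ≡ true → prot c u ≡ true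
        surrounded u vu with col u ≤? j
        ... | yes col≤j = from (protected u) (inj₁ col≤j)
        ... | no  col≰j = from (protected u) (inj₂ (≤-antisym (col≤1+j u) (≰⇒> col≰j) ,
                            ≤-trans (proj₂ (proj₁ (adj⇒near d {pos c i} {u} vu))) row<q , 1≤q))

      only-neighbour : row d (pos c i) ≡ q → ∀ {u} → adj (pos c i) u ≡ true → prot c u ≡ false →
                       u ≡ next (suc q)
      only-neighbour row-i {u} vu pu = at-unique d u
        (≤-antisym (subst (λ x → row d u ≤ suc x) row-i (proj₂ (proj₁ (adj⇒near d {pos c i} {u} vu))))
                   (≰⇒> (λ row≤q → proj₂ (unprotected-col pu (col≤1+j u)) (row≤q , 1≤q))))
        (proj₁ (unprotected-col pu (col≤1+j u)))

      step-down : row d (pos c i) ≡ q → adj (pos c i) (next (suc q)) ≡ true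
      step-down row-i = adj-down d {pos c i} {next (suc q)} (trans col-i (sym (col-next (suc q))))
        (trans (row-next q<M) (cong suc (sym row-i)))

    stays : ∀ {i} → fires c (pos c i) ≡ false → moves c i ≡ false
    stays {i} still = trans (cong (mobile c i ∧_) still) (∧-zeroʳ _)

    active-moves : ∀ {i} → stage (slot i) ≡ suc q → moves c i ≡ true
    active-moves {i} act = cong₂ _∧_ (mobile-at i (Active.used-i act)) (active-fires act)

    moves⇒fires : ∀ {i} → moves c i ≡ true → fires c (pos c i) ≡ true
    moves⇒fires {i} mv = proj₂ (∧-true {mobile c i} mv)

    τ : Fin s → Cell m (suc N)
    τ i = if stage (slot i) ≤ᵇ q then next (suc q) else next (target (slot i))

    τ-done : ∀ {i} → stage (slot i) ≤ q → τ i ≡ next (suc q)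
    τ-done ≤q rewrite ≤ᵇ-true ≤q = refl

    τ-active : ∀ {i} (act : stage (slot i) ≡ suc q) → τ i ≡ destination act
    τ-active act rewrite ≤ᵇ-false (<⇒≱ (≤-reflexive (sym act))) = refl

    legal : ∀ i → moves c i ≡ true → adj (pos c i) (τ i) ≡ true × prot c (τ i) ≡ false
    legal i mv with status i
    ... | pending pend = contradiction (trans (sym mv) (stays (pending-still pend))) λ ()
    ... | active  act  rewrite τ-active act = to-destination act , destination-fresh act
    ... | done    ≤q   with position in pos≡
    ...   | interior _ = contradiction (trans (sym mv) (stays (interior-done-still pos≡ ≤q))) λ ()
    ...   | final    _ rewrite τ-done ≤q =
      FinalDone.step-down pos≡ ≤q (FinalDone.firing-row pos≡ ≤q (moves⇒fires mv)) , fresh (inj₂ ≤-refl) q<M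

    covering : ∀ v u → fires c v ≡ true → adj v u ≡ true → prot c u ≡ false →
               ∃ λ i → moves c i ≡ true × pos c i ≡ v × τ i ≡ u
    covering v u fires-v vu pu with firing-searcher c {v} fires-v
    ... | i , refl , mob with status i
    ...   | pending pend = contradiction (trans (sym fires-v) (pending-still pend)) λ ()
    ...   | active  act  = let i′ , act′ , same , dest≡ = active-covers act vu pu in
                           i′ , active-moves act′ , same , trans (τ-active act′) dest≡
    ...   | done    ≤q   with position in pos≡
    ...     | interior _ = contradiction (trans (sym fires-v) (interior-done-still pos≡ ≤q)) λ ()
    ...     | final    _ = i , cong₂ _∧_ mob fires-v , refl ,
      trans (τ-done ≤q) (sym (FinalDone.only-neighbour pos≡ ≤q (FinalDone.firing-row pos≡ ≤q fires-v) vu pu))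

    c′ : Config s
    c′ = advance c τ

    step : Step c c′
    step = advance-step c τ legal covering

    pos′-moved : ∀ {i} → moves c i ≡ true → pos c′ i ≡ τ i
    pos′-moved {i} mv = cong (if_then τ i else pos c i) mv

    pos′-stayed : ∀ {i} → moves c i ≡ false → pos c′ i ≡ pos c i
    pos′-stayed {i} st = cong (if_then τ i else pos c i) st

    used′-moved : ∀ {i} → moves c i ≡ true → used c′ i ≡ suc (used c i)
    used′-moved {i} mv = cong (if_then suc (used c i) else used c i) mv

    used′-stayed : ∀ {i} → moves c i ≡ false → used c′ i ≡ used c i
    used′-stayed {i} st = cong (if_then suc (used c i) else used c i) st

    active-lands : ∀ {i} (act : stage (slot i) ≡ suc q) → pos c′ i ≡ destination act
    active-lands act = trans (pos′-moved (active-moves act)) (τ-active act)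

    next-protected : ∀ {r} → r ≤ suc q → r ≤ M → Protected d j (suc q) (next r)
    next-protected {r} r≤ r≤M = inj₂ (col-next r , subst (_≤ suc q) (sym (row-next r≤M)) r≤ , s≤s z≤n)

    τ-protected : ∀ i → moves c i ≡ true → Protected d j (suc q) (τ i)
    τ-protected i mv with status i
    ... | pending pend = contradiction (trans (sym mv) (stays (pending-still pend))) λ ()
    ... | active  act  rewrite τ-active act =
      next-protected (subst (target (slot i) ≤_) act (target≤stage (slot i))) (target≤M (slot i) (slot-valid i))
    ... | done    ≤q   rewrite τ-done ≤q = next-protected ≤-refl q<M

    lands-protected : ∀ i → Protected d j (suc q) (pos c′ i)
    lands-protected i with moves c i in mv
    ... | true  = τ-protected i mv
    ... | false = Protected-mono {d} {j} {q} {pos c i} (on-protected i)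

    newly-occupied : ∀ v → Protected d j (suc q) v → ¬ Protected d j q v → ∃ λ i → pos c′ i ≡ v
    newly-occupied v (inj₁ col≤j) ¬P = contradiction (inj₁ col≤j) ¬P
    newly-occupied v (inj₂ (col≡ , row≤ , _)) ¬P with row d v ≟ suc q | 1 ≤? q
    ... | yes row≡ | _ = i , trans (active-lands act) (sym (at-unique d v (trans row≡ (sym target≡)) col≡))
      where
      onto = slot-onto (diagonal q) q<M
      i = proj₁ onto
      act : stage (slot i) ≡ suc q
      act = cong stage (proj₂ onto)
      target≡ : target (slot i) ≡ suc q
      target≡ = cong target (proj₂ onto)
    ... | no row≢ | yes 1≤q = contradiction (inj₂ (col≡ , ≤-pred (≤∧≢⇒< row≤ row≢) , 1≤q)) ¬P
    ... | no row≢ | no  1≰q = let open FirstStage q≡0 in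
      straight₀ , trans (active-lands straight₀-active)
        (trans destination-straight₀
          (sym (at-unique d v (n≤0⇒n≡0 (subst (row d v ≤_) q≡0 (≤-pred (≤∧≢⇒< row≤ row≢)))) col≡)))
      where q≡0 = n<1⇒n≡0 (≰⇒> 1≰q)

    protected′ : ∀ v → prot c′ v ≡ true ⇔ Protected d j (suc q) v
    protected′ v = mk⇔ to′ from′
      where
      to′ : prot c′ v ≡ true → Protected d j (suc q) v
      to′ pv′ with prot c v in pv
      ... | true  = Protected-mono {d} {j} {q} {v} (to (protected v) pv)
      ... | false = let i , at-v = occupant c′ pv′ in subst (Protected d j (suc q)) at-v (lands-protected i)
      from′ : Protected d j (suc q) v → prot c′ v ≡ true
      from′ P with prot c v in pv
      ... | true  = refl
      ... | false = let i , at-v = newly-occupied v P (unprotected⁻ pv) in occupied c′ i at-v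

    waiting′ : ∀ i → suc q < stage (slot i) →
               row d (pos c′ i) ≡ source (slot i) × col (pos c′ i) ≡ j × used c′ i ≡ j
    waiting′ i pend =
      let row≡ , col≡ , used≡ = waiting i (<⇒≤ pend)
          st = stays (pending-still pend)
      in trans (cong (row d) (pos′-stayed st)) row≡ , trans (cong col (pos′-stayed st)) col≡ ,
         trans (used′-stayed st) used≡

    landed′ : ∀ i → stage (slot i) ≤ suc q → Landed position d (suc q) (slot i) (pos c′ i) (used c′ i)
    landed′ i ≤q+1 with position in pos≡ | status i
    ... | _          | pending pend = contradiction ≤q+1 (<⇒≱ pend)
    ... | interior _ | done ≤q =
      let row≡ , col≡ , used≡ = landed-interior pos≡ i ≤q
          st = stays (interior-done-still pos≡ ≤q)
      in trans (cong (row d) (pos′-stayed st)) row≡ , trans (cong col (pos′-stayed st)) col≡ ,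
         trans (used′-stayed st) used≡
    ... | interior _ | active act =
      trans (cong (row d) (active-lands act)) (row-next (target≤M (slot i) (slot-valid i))) ,
      trans (cong col (active-lands act)) (col-next (target (slot i))) ,
      trans (used′-moved (active-moves act)) (cong suc (Active.used-i act))
    ... | final _    | active act =
      trans (cong col (active-lands act)) (col-next (target (slot i))) ,
      subst (_≤ suc q) (sym (trans (cong (row d) (active-lands act)) (row-next (target≤M (slot i) (slot-valid i)))))
        (subst (target (slot i) ≤_) act (target≤stage (slot i)))
    ... | final _    | done ≤q with moves c i in mv
    ...   | true  = trans (cong col (τ-done ≤q)) (col-next (suc q)) ,
                    ≤-reflexive (trans (cong (row d) (τ-done ≤q)) (row-next q<M))
    ...   | false = let col≡ , row≤q = landed-final pos≡ i ≤q in col≡ , m≤n⇒m≤1+n row≤q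

    sweeping′ : Sweeping d j (suc q) c′
    sweeping′ = record
      { position       = position
      ; slot           = slot
      ; slot-valid     = slot-valid
      ; slot-injective = slot-injective
      ; slot-onto      = slot-onto
      ; protected      = protected′
      ; waiting        = waiting′
      ; landed         = landed′
      }

  run-phase : ∀ t {d j q c} → q + t ≡ M → Sweeping d j q c → ∃ λ c′ → Star Step c c′ × Sweeping d j M c′
  run-phase zero {d} {j} {q} {c} q+0≡M I =
    c , ε , subst (λ x → Sweeping d j x c) (trans (sym (+-identityʳ q)) q+0≡M) I
  run-phase (suc t) {q = q} q+t+1≡M I =
    let q<M = subst (q <_) q+t+1≡M (m<m+n q (s≤s z≤n))
        c″ , steps , I″ = run-phase t (trans (sym (+-suc q t)) q+t+1≡M) (Stage.sweeping′ I q<M)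
    in c″ , Stage.step I q<M ◅ steps , I″

  position-after : ∀ {j} → suc (suc j) ≤ N → Position (suc j)
  position-after {j} j+2≤N with suc (suc j) ≟ N
  ... | yes j+2≡N = final j+2≡N
  ... | no  j+2≢N = interior (≤∧≢⇒< j+2≤N j+2≢N)

  -- At the end of a phase the searchers stand on the next column, two of them at the
  -- far end, and the sweep continues in the reflected direction.
  turn : ∀ {d j c} → Sweeping d j M c → suc (suc j) ≤ N → Sweeping (not d) (suc j) 0 c
  turn {d} {j} {c} I j+2≤N with Sweeping.position I in pos≡
  ... | final j+1≡N = contradiction j+2≤N (<-irrefl j+1≡N)
  ... | interior h = record
    { position       = position-after j+2≤N
    ; slot           = reflect ∘ slot
    ; slot-valid     = λ i → reflect-valid (slot i) (slot-valid i)
    ; slot-injective = λ {i} {i′} eq → slot-injective (begin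
        slot i                     ≡⟨ sym (reflect-involutive (slot i) (slot-valid i)) ⟩
        reflect (reflect (slot i))  ≡⟨ cong reflect eq ⟩
        reflect (reflect (slot i′)) ≡⟨ reflect-involutive (slot i′) (slot-valid i′) ⟩
        slot i′                    ∎)
    ; slot-onto      = λ ρ valid → let i , slot≡ = slot-onto (reflect ρ) (reflect-valid ρ valid) in
                         i , trans (cong reflect slot≡) (reflect-involutive ρ valid)
    ; protected      = λ v → mk⇔ (reflected v ∘ to (protected v)) (from (protected v) ∘ reflected⁻ v)
    ; waiting        = λ i _ → let row≡ , col≡ , used≡ = on-next-column i in
        trans (row-not d (pos c i)) (trans (cong (M ∸_) row≡) (reflect-source (slot i))) , col≡ , used≡
    ; landed         = λ i stage≤0 → contradiction (≤-trans (stage≥1 (reflect (slot i))) stage≤0) λ ()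
    }
    where
    open Sweeping I
    open ≡-Reasoning
    on-next-column : ∀ i → row d (pos c i) ≡ target (slot i) × col (pos c i) ≡ suc j × used c i ≡ suc j
    on-next-column i = subst (λ p → Landed p d M (slot i) (pos c i) (used c i)) pos≡
                             (landed i (stage≤M (slot i) (slot-valid i)))
    reflected : ∀ v → Protected d j M v → Protected (not d) (suc j) 0 v
    reflected v (inj₁ col≤j)       = inj₁ (m≤n⇒m≤1+n col≤j)
    reflected v (inj₂ (col≡ , _)) = inj₁ (≤-reflexive col≡)
    reflected⁻ : ∀ v → Protected (not d) (suc j) 0 v → Protected d j M v
    reflected⁻ v (inj₁ col≤1+j) with col v ≤? j
    ... | yes col≤j = inj₁ col≤j
    ... | no  col≰j = inj₂ (≤-antisym col≤1+j (≰⇒> col≰j) , row≤M d v , ≤-trans (n≤1+n 1) 2≤M)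
    reflected⁻ v (inj₂ (_ , _ , ()))

  finished : ∀ {d j c} → Sweeping d j M c → suc j ≡ N → ∀ v → prot c v ≡ true
  finished {d} {j} I j+1≡N v with col v ≤? j
  ... | yes col≤j = from (Sweeping.protected I v) (inj₁ col≤j)
  ... | no  col≰j = from (Sweeping.protected I v)
    (inj₂ (≤-antisym (subst (col v ≤_) (sym j+1≡N) (col≤N v)) (≰⇒> col≰j) ,
           row≤M d v , ≤-trans (n≤1+n 1) 2≤M))

  sweep : ∀ t {d j c} → suc j + t ≡ N → Sweeping d j 0 c →
          ∃ λ c′ → Star Step c c′ × ∀ v → prot c′ v ≡ true
  sweep t {j = j} j+1+t≡N I with run-phase M refl I
  ... | c′ , steps , I′ with Sweeping.position I′ | t
  ...   | final j+1≡N | _     = c′ , steps , finished I′ j+1≡N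
  ...   | interior j+2≤N | zero = contradiction (trans (sym (+-identityʳ (suc j))) j+1+t≡N) (<⇒≢ j+2≤N)
  ...   | interior j+2≤N | suc t′ =
    let c″ , steps′ , complete = sweep t′ (trans (sym (+-suc (suc j) t′)) j+1+t≡N) (turn I′ j+2≤N) in
    c″ , steps ◅◅ steps′ , complete

  layout : Fin s → Cell m (suc N)
  layout i = at false (source (role i)) 0

  initial-sweeping : 1 ≤ N → Sweeping false 0 0 (initial layout)
  initial-sweeping 1≤N = record
    { position       = start
    ; slot           = role
    ; slot-valid     = role-valid
    ; slot-injective = role-injective
    ; slot-onto      = role-onto
    ; protected      = λ v → mk⇔ (occupied⇒column-0 v) (column-0⇒occupied v)
    ; waiting        = λ i _ → row-at false 0 (source≤M (role i) (role-valid i)) ,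
                               col-at false (source (role i)) z≤n , refl
    ; landed         = λ i stage≤0 → contradiction (≤-trans (stage≥1 (role i)) stage≤0) λ ()
    }
    where
    start : Position 0
    start with 2 ≤? N
    ... | yes 2≤N = interior 2≤N
    ... | no  2≰N = final (≤-antisym 1≤N (≤-pred (≰⇒> 2≰N)))
    occupied⇒column-0 : ∀ v → prot (initial layout) v ≡ true → Protected false 0 0 v
    occupied⇒column-0 v pv = let i , at-v = occupant (initial layout) {v} pv in
      inj₁ (≤-reflexive (trans (cong col (sym at-v)) (col-at false (source (role i)) z≤n)))
    column-0⇒occupied : ∀ v → Protected false 0 0 v → prot (initial layout) v ≡ true
    column-0⇒occupied v (inj₁ col≤0) =
      let ρ , valid , source≡ = source-onto (row false v) (row≤M false v)
          i , role≡ = role-onto ρ valid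
      in occupied (initial layout) i
           (sym (at-unique false v (trans (sym source≡) (cong source (sym role≡))) (n≤0⇒n≡0 col≤0)))
    column-0⇒occupied v (inj₂ (_ , _ , ()))

  upperBound : 1 ≤ N → Σ (Fin s → Cell m (suc N)) Successful
  upperBound 1≤N = layout , sweep (N ∸ 1) (m+[n∸m]≡n 1≤N) (initial-sweeping 1≤N)

theorem5p2 : (k m n : ℕ) → 1 ≤ k → 3 ≤ m → m ≤ n → n ≤ k + 1 →
    DeductionNumber (strongGrid m n) k (m + 1)
theorem5p2 k (suc M) (suc N) _ m≥3@(s≤s 2≤M) m≤n@(s≤s M≤N) n≤k+1 =
  subst (λ s → Σ (Fin s → Cell (suc M) (suc N)) (Game.Successful (strongGrid (suc M) (suc N)) k))
        (+-comm 1 (suc M)) (Sweep.upperBound M N k 2≤M N≤k 1≤N) ,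
  λ s L successful → subst (_≤ s) (+-comm 1 (suc M))
                       (LowerBound.lowerBound (suc M) (suc N) k m≥3 m≤n s L successful)
  where
  N≤k : N ≤ k
  N≤k = ≤-pred (subst (suc N ≤_) (+-comm k 1) n≤k+1)
  1≤N : 1 ≤ N
  1≤N = ≤-trans (n≤1+n 1) (≤-trans 2≤M M≤N)
theorem5p2 k zero    _    _ ()  _  _
theorem5p2 k (suc M) zero _ _   () _
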